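{- Fix $N\ge1$ and consider prefixes for $I_N=\mathrm{Av}_N(321)$, with strike probabilities regarded as pairs (numerator, denominator). (1) If $p$ is an eligible prefix containing at least one inversion, then $S_N(p)=S_{N-1}(\check p)$, where $\check p$ is obtained from $p$ by removing the value $1$ and flattening, and $S_{N-1}$ is computed with respect to $\mathrm{Av}_{N-1}(321)$. (2) If $p=12\cdots k$ with $1\le k\le N$, then $S_N(p)$ has numerator $\binom{N-1}{k-1}$ and denominator $\frac{k+1}{N+1}\binom{2N-k}{N}$.
   Context: $\mathrm{Av}_N(321)$ is the set of permutations $\pi=\pi_1\cdots\pi_N$ of $[N]$ with no indices $a<b<c$ such that $\pi_a>\pi_b>\pi_c$. The $i$th prefix flattening $\pi|_{[i]}$ is the permutation of $[i]$ in the same relative order as $\pi_1,\dots,\pi_i$. A prefix (of rank $N$) is a permutation $p$ of $[k]$, $1\le k\le N$, with $p=\pi|_{[k]}$ for some $\pi\in\mathrm{Av}_N(321)$. A prefix $p=p_1\cdots p_k$ is eligible if $p_k=k$; it contains an inversion if $p_a>p_b$ for some $a<b$. The strike probability of a prefix $p$ of size $k$ is the pair $S_N(p)=\big(\#\{\pi\in\mathrm{Av}_N(321):\pi|_{[k]}=p,\ \pi_k=N\},\ \#\{\pi\in\mathrm{Av}_N(321):\pi|_{[k]}=p\}\big)$. -}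

module Defs where

open import Data.Nat using (ℕ; zero; suc; _<_; _≤_; _<?_; _≟_)
open import Relation.Binary.PropositionalEquality using (_≡_)
open import Data.Fin using (Fin) renaming (_<_ to _<ᶠ_; _<?_ to _<ᶠ?_)
open import Data.Fin.Properties using (any?)
open import Data.List using (List; []; _∷_; map; concatMap; filter; length; take; upTo; lookup)
open import Data.List.Relation.Unary.Unique.Propositional using (Unique)
import Data.List.Relation.Unary.Unique.DecPropositional as UDec
open import Data.Product using (Σ; ∃; _×_; _,_)
open import Relation.Nullary using (Dec; ¬_; ¬?)
open import Relation.Nullary.Decidable using (_×-dec_)
open import Relation.Unary using (Decidable)

range : ℕ → List ℕ
range m = map suc (upTo m)

words : ℕ → ℕ → List (List ℕ)
words m zero    = [] ∷ []
words m (suc n) = concatMap (λ w → map (_∷ w) (range m)) (words m n)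

-- a word of length N over [N] is a permutation of [N] iff its entries are distinct
IsPerm : List ℕ → Set
IsPerm π = Unique π

isPerm? : Decidable IsPerm
isPerm? = UDec.unique? _≟_

Has321 : List ℕ → Set
Has321 π = Σ (Fin (length π)) λ a → Σ (Fin (length π)) λ b → Σ (Fin (length π)) λ c →
  (a <ᶠ b) × (b <ᶠ c) × (lookup π b < lookup π a) × (lookup π c < lookup π b)

has321? : Decidable Has321
has321? π = any? λ a → any? λ b → any? λ c →
  (a <ᶠ? b) ×-dec (b <ᶠ? c) ×-dec (lookup π b <? lookup π a) ×-dec (lookup π c <? lookup π b)

Avoids321 : List ℕ → Set
Avoids321 π = ¬ Has321 π

Av : ℕ → List (List ℕ)
Av N = filter (λ π → isPerm? π ×-dec ¬? (has321? π)) (words N N)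

flatten : List ℕ → List ℕ
flatten xs = map (λ x → suc (length (filter (_<? x) xs))) xs

prefixFlat : ℕ → List ℕ → List ℕ
prefixFlat i π = flatten (take i π)

-- 1-indexed entry π_i (0 if out of range)
entry : List ℕ → ℕ → ℕ
entry []       _             = 0
entry (x ∷ xs) zero          = 0
entry (x ∷ xs) (suc zero)    = x
entry (x ∷ xs) (suc (suc i)) = entry xs (suc i)

IsPrefix : ℕ → List ℕ → Set
IsPrefix N p = Σ (List ℕ) λ π → (IsPerm π × Avoids321 π × length π ≡ N) × (1 ≤ length p × length p ≤ N) × prefixFlat (length p) π ≡ p

Eligible : List ℕ → Set
Eligible p = entry p (length p) ≡ length p

HasInversion : List ℕ → Set
HasInversion p = Σ (Fin (length p)) λ a → Σ (Fin (length p)) λ b → (a <ᶠ b) × (lookup p b < lookup p a)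

S : ℕ → List ℕ → ℕ × ℕ
S N p =
  ( length (filter (λ π → (prefixFlat k π ≟ₗ p) ×-dec (entry π k ≟ N)) (Av N))
  , length (filter (λ π → prefixFlat k π ≟ₗ p) (Av N)) )
  where
  open import Data.List.Properties using (≡-dec)
  k = length p
  _≟ₗ_ = ≡-dec _≟_

removeOne : List ℕ → List ℕ
removeOne p = flatten (filter (λ x → ¬? (x ≟ 1)) p)

idPrefix : ℕ → List ℕ
idPrefix k = range k

-- Every π ∈ Av (n + 1) arises in exactly one way by inserting a new minimum 1 into some
-- σ ∈ Av n after its first j entries, and σ must be increasing on those j entries, since an
-- inversion there followed by the 1 would be a 321. All counts go through this bijection.
-- (1) For an eligible p = insertOne j₀ q with an inversion, the 1 is not last in p, so the
-- prefix p forces j = j₀ and π ↦ σ matches the permutations with prefix p (and N at position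
-- k) with those with prefix q = p̌ (and N − 1 at position k − 1).
-- (2) The numbers F n k of σ ∈ Av n increasing on their first k entries, and G n k of those
-- that moreover have n at position k, satisfy F (n + 1) (k + 1) = F n k + F (n + 1) (k + 2),
-- F n n = 1, F n 0 = F n 1 and G (n + 1) (k + 1) = G n k + G n (k + 1): the recurrences of
-- the ballot numbers and of Pascal's triangle.

module Submission where

open import Defs
open import Data.Nat using (ℕ; suc; _+_; _*_; _∸_; _≤_)
open import Data.Nat.Combinatorics using (_C_)
open import Data.Product using (_×_; proj₁; proj₂)
open import Data.List using (List)
open import Relation.Binary.PropositionalEquality using (_≡_)

open import Level using (Level)
open import Function using (_∘_; id; _⇔_; mk⇔; Equivalence)
open import Data.Empty using (⊥-elim)
open import Data.Product using (Σ; _,_; uncurry)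
import Data.Product as Product
open import Data.Sum using (_⊎_; inj₁; inj₂; [_,_]′)
open import Relation.Nullary using (yes; no; ¬_; ¬?)
open import Relation.Nullary.Decidable using (_×-dec_)
open import Relation.Unary using (Pred; Decidable)
open import Relation.Binary using (tri<; tri≈; tri>)
open import Relation.Binary.PropositionalEquality
  using (_≢_; refl; sym; trans; cong; cong₂; subst; subst₂; module ≡-Reasoning)

open import Data.Nat using (zero; pred; _<_; z≤n; s≤s; _≟_; _<?_; _≤?_)
open import Data.Nat.Properties
  using (module ≤-Reasoning; suc-injective; 0≢1+n;
         ≤-refl; ≤-reflexive; ≤-trans; ≤-antisym; ≤-pred; n≤1+n; m≤m+n; m≤n+m; <-irrefl; <-trans; <-≤-trans; <-cmp;
         <⇒≤; <⇒≢; ≮⇒≥; ≰⇒>; ≤∧≢⇒<; m<m+n; m≤n⇒m<n∨m≡n; m⊓n≤m; m≤n⇒m⊓n≡m;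
         +-identityʳ; +-comm; +-assoc; +-suc; +-cancelˡ-≡; +-monoʳ-≤; +-commutativeSemigroup;
         *-identityˡ; *-identityʳ; *-zeroʳ; *-distribˡ-+; *-distribʳ-+; *-cancelˡ-≡;
         n∸n≡0; +-∸-assoc; m∸n+n≡m; m+n∸n≡m; m+[n∸m]≡n)
open import Algebra.Properties.CommutativeSemigroup +-commutativeSemigroup using (x∙yz≈y∙xz)
open import Data.Nat.Combinatorics using (nCn≡1; nC1≡n; nCk+nC[k+1]≡[n+1]C[k+1])
open import Data.Nat.Tactic.RingSolver using (solve-∀)
open import Data.Fin using (Fin) renaming (zero to fzero; suc to fsuc; _<_ to _<ᶠ_)

open import Data.List using ([]; _∷_; [_]; _++_; length; filter; map; take; drop; upTo; lookup)
open import Data.List.Properties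
  using (∷-injectiveˡ; ∷-injectiveʳ; length-++; length-map; length-take; length-upTo; map-∘; map-cong; map-cong-local;
         map-id-local; map-injective; map-applyUpTo; take-map; drop-map; take-take; take++drop≡id;
         filter-accept; filter-++; filter-none; filter-notAll)
open import Data.List.Membership.Propositional using (_∈_; _∉_; find)
open import Data.List.Membership.DecPropositional _≟_ using (_∈?_)
open import Data.List.Membership.Propositional.Properties
  using (∈-map⁻; ∈-map⁺; ∈-lookup; ∈-upTo⁺; ∈-upTo⁻; ∈-concatMap⁺; ∈-concatMap⁻; ∈-∃++; ∈-++⁻; ∈-++⁺ˡ; ∈-++⁺ʳ;
         ∈-filter⁻; ∈-filter⁺)
open import Data.List.Relation.Unary.Any using (Any; here; there; any?)
import Data.List.Relation.Unary.Any as Any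
open import Data.List.Relation.Unary.Any.Properties using (lookup-index)
import Data.List.Relation.Unary.All as All
import Data.List.Relation.Unary.All.Properties as All
import Data.List.Relation.Unary.AllPairs as AllPairs
import Data.List.Relation.Unary.AllPairs.Properties as AllPairs
open import Data.List.Relation.Unary.Unique.Propositional using (Unique; []; _∷_)
open import Data.List.Relation.Unary.Unique.Propositional.Properties using (Unique[x∷xs]⇒x∉xs)
import Data.List.Relation.Unary.Unique.Propositional.Properties as Unique
open import Data.List.Relation.Binary.Disjoint.Propositional using (Disjoint)
open import Data.List.Relation.Binary.Permutation.Propositional using (↭-sym)
open import Data.List.Relation.Binary.Permutation.Propositional.Properties using (↭-length; shift)
open import Data.List.Relation.Binary.Sublist.Propositional
  using (_⊆_; []; _∷_; _∷ʳ_; ⊆-refl; ⊆-trans; minimum; from∈; to∈) renaming (lookup to ∈-⊆)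
open import Data.List.Relation.Binary.Sublist.Propositional.Properties using (map⁺; ++⁺; take-⊆; take⁺; length-mono-≤)

private variable
  a ℓ ℓ′ : Level
  A B : Set a

-- Counting and finite sums

count : {P : Pred A ℓ} → Decidable P → List A → ℕ
count P? xs = length (filter P? xs)

module _ {P : Pred A ℓ} (P? : Decidable P) where

  count-accept : ∀ {x xs} → P x → count P? (x ∷ xs) ≡ suc (count P? xs)
  count-accept {xs = xs} px = cong length (filter-accept P? {xs = xs} px)

  count-none : ∀ {xs} → (∀ {x} → x ∈ xs → ¬ P x) → count P? xs ≡ 0
  count-none ¬P = cong length (filter-none P? (All.tabulate ¬P))

  count<length : ∀ {x xs} → x ∈ xs → ¬ P x → count P? xs < length xs
  count<length x∈xs ¬px = filter-notAll P? _ (Any.map (λ { refl → ¬px }) x∈xs)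

  count-++ : ∀ xs ys → count P? (xs ++ ys) ≡ count P? xs + count P? ys
  count-++ xs ys = trans (cong length (filter-++ P? xs ys)) (length-++ (filter P? xs))

  count-middle : ∀ xs y ys → count P? (xs ++ y ∷ ys) ≡ count P? (y ∷ xs ++ ys)
  count-middle xs y ys = begin
    count P? (xs ++ y ∷ ys)                        ≡⟨ count-++ xs (y ∷ ys) ⟩
    count P? xs + count P? ([ y ] ++ ys)           ≡⟨ cong (count P? xs +_) (count-++ [ y ] ys) ⟩
    count P? xs + (count P? [ y ] + count P? ys)   ≡⟨ x∙yz≈y∙xz (count P? xs) (count P? [ y ]) (count P? ys) ⟩
    count P? [ y ] + (count P? xs + count P? ys)   ≡⟨ cong (count P? [ y ] +_) (count-++ xs ys) ⟨
    count P? [ y ] + count P? (xs ++ ys)           ≡⟨ count-++ [ y ] (xs ++ ys) ⟨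
    count P? (y ∷ xs ++ ys)                        ∎
    where open ≡-Reasoning

module _ {P : Pred A ℓ} {Q : Pred A ℓ′} (P? : Decidable P) (Q? : Decidable Q) where

  count-cong : ∀ xs → (∀ {x} → x ∈ xs → P x → Q x) → (∀ {x} → x ∈ xs → Q x → P x) →
               count P? xs ≡ count Q? xs
  count-cong []       P⇒Q Q⇒P = refl
  count-cong (x ∷ xs) P⇒Q Q⇒P with P? x | Q? x
  ... | yes _  | yes _  = cong suc (count-cong xs (P⇒Q ∘ there) (Q⇒P ∘ there))
  ... | yes px | no ¬qx = ⊥-elim (¬qx (P⇒Q (here refl) px))
  ... | no ¬px | yes qx = ⊥-elim (¬px (Q⇒P (here refl) qx))
  ... | no _   | no _   = count-cong xs (P⇒Q ∘ there) (Q⇒P ∘ there)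

  count-mono : (∀ {x} → P x → Q x) → ∀ xs → count P? xs ≤ count Q? xs
  count-mono P⇒Q []       = z≤n
  count-mono P⇒Q (x ∷ xs) with P? x | Q? x
  ... | yes _  | yes _  = s≤s (count-mono P⇒Q xs)
  ... | yes px | no ¬qx = ⊥-elim (¬qx (P⇒Q px))
  ... | no _   | yes _  = ≤-trans (count-mono P⇒Q xs) (n≤1+n _)
  ... | no _   | no _   = count-mono P⇒Q xs

  count-strict : (∀ {x} → P x → Q x) → ∀ {y xs} → y ∈ xs → ¬ P y → Q y → count P? xs < count Q? xs
  count-strict P⇒Q {xs = x ∷ xs} y∈ ¬py qy with P? x | Q? x | y∈
  ... | yes px | _      | here refl = ⊥-elim (¬py px)
  ... | _      | no ¬qx | here refl = ⊥-elim (¬qx qy)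
  ... | no _   | yes _  | here refl = s≤s (count-mono P⇒Q xs)
  ... | yes _  | yes _  | there y∈′ = s≤s (count-strict P⇒Q y∈′ ¬py qy)
  ... | yes px | no ¬qx | there _   = ⊥-elim (¬qx (P⇒Q px))
  ... | no _   | yes _  | there y∈′ = ≤-trans (count-strict P⇒Q y∈′ ¬py qy) (n≤1+n _)
  ... | no _   | no _   | there y∈′ = count-strict P⇒Q y∈′ ¬py qy

module _ {P : Pred B ℓ} (P? : Decidable P) where

  count-map : (f : A → B) → ∀ xs → count P? (map f xs) ≡ count (P? ∘ f) xs
  count-map f []       = refl
  count-map f (x ∷ xs) with P? (f x)
  ... | yes _ = cong suc (count-map f xs)
  ... | no _  = count-map f xs

length-≤-injection : (f : A → B) → ∀ xs ys → Unique xs → (∀ {x} → x ∈ xs → f x ∈ ys) →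
                     (∀ {x y} → x ∈ xs → y ∈ xs → f x ≡ f y → x ≡ y) → length xs ≤ length ys
length-≤-injection f []       ys _             _  _   = z≤n
length-≤-injection f (x ∷ xs) ys u@(_ ∷ uxs) f∈ inj with ∈-∃++ (f∈ (here refl))
... | ys₁ , ys₂ , refl =
  ≤-trans (s≤s (length-≤-injection f xs (ys₁ ++ ys₂) uxs f∈ys₁++ys₂ (λ p q → inj (there p) (there q))))
          (≤-reflexive (↭-length (↭-sym (shift (f x) ys₁ ys₂))))
  where
  f∈ys₁++ys₂ : ∀ {y} → y ∈ xs → f y ∈ ys₁ ++ ys₂
  f∈ys₁++ys₂ {y} y∈xs with ∈-++⁻ ys₁ (f∈ (there y∈xs))
  ... | inj₁ p         = ∈-++⁺ˡ p
  ... | inj₂ (there p) = ∈-++⁺ʳ ys₁ p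
  ... | inj₂ (here fy≡fx) with inj (there y∈xs) (here refl) fy≡fx
  ...   | refl = ⊥-elim (Unique[x∷xs]⇒x∉xs u y∈xs)

count-≤-injection : {P : Pred A ℓ} {Q : Pred B ℓ′} (P? : Decidable P) (Q? : Decidable Q) →
                    ∀ {xs ys} → Unique xs → (f : A → B) (g : B → A) →
                    (∀ {x} → x ∈ xs → P x → f x ∈ ys × Q (f x) × g (f x) ≡ x) →
                    count P? xs ≤ count Q? ys
count-≤-injection P? Q? {xs} {ys} u f g fwd =
  length-≤-injection f (filter P? xs) (filter Q? ys) (Unique.filter⁺ P? u) f∈ injective
  where
  f∈ : ∀ {x} → x ∈ filter P? xs → f x ∈ filter Q? ys
  f∈ x∈ with ∈-filter⁻ P? x∈
  ... | x∈xs , px = ∈-filter⁺ Q? (proj₁ (fwd x∈xs px)) (proj₁ (proj₂ (fwd x∈xs px)))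
  g∘f≡id : ∀ {x} → x ∈ filter P? xs → g (f x) ≡ x
  g∘f≡id x∈ with ∈-filter⁻ P? x∈
  ... | x∈xs , px = proj₂ (proj₂ (fwd x∈xs px))
  injective : ∀ {x y} → x ∈ filter P? xs → y ∈ filter P? xs → f x ≡ f y → x ≡ y
  injective x∈ y∈ fx≡fy = trans (sym (g∘f≡id x∈)) (trans (cong g fx≡fy) (g∘f≡id y∈))

count-bijection : {P : Pred A ℓ} {Q : Pred B ℓ′} (P? : Decidable P) (Q? : Decidable Q) →
                  ∀ {xs ys} → Unique xs → Unique ys → (f : A → B) (g : B → A) →
                  (∀ {x} → x ∈ xs → P x → f x ∈ ys × Q (f x) × g (f x) ≡ x) →
                  (∀ {y} → y ∈ ys → Q y → g y ∈ xs × P (g y) × f (g y) ≡ y) →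
                  count P? xs ≡ count Q? ys
count-bijection P? Q? uxs uys f g fwd bwd =
  ≤-antisym (count-≤-injection P? Q? uxs f g fwd) (count-≤-injection Q? P? uys g f bwd)

sumBelow : ℕ → (ℕ → ℕ) → ℕ
sumBelow zero    h = 0
sumBelow (suc m) h = h 0 + sumBelow m (h ∘ suc)

syntax sumBelow m (λ j → e) = ∑[ j < m ] e

∑-cong : ∀ m {h h′ : ℕ → ℕ} → (∀ j → j < m → h j ≡ h′ j) → sumBelow m h ≡ sumBelow m h′
∑-cong zero    h≡h′ = refl
∑-cong (suc m) h≡h′ = cong₂ _+_ (h≡h′ 0 (s≤s z≤n)) (∑-cong m (λ j j<m → h≡h′ (suc j) (s≤s j<m)))

∑-zero : ∀ m {h : ℕ → ℕ} → (∀ j → j < m → h j ≡ 0) → sumBelow m h ≡ 0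
∑-zero zero    h≡0 = refl
∑-zero (suc m) h≡0 = cong₂ _+_ (h≡0 0 (s≤s z≤n)) (∑-zero m (λ j j<m → h≡0 (suc j) (s≤s j<m)))

∑-distrib-+ : ∀ m (h h′ : ℕ → ℕ) → ∑[ j < m ] (h j + h′ j) ≡ sumBelow m h + sumBelow m h′
∑-distrib-+ zero    h h′ = refl
∑-distrib-+ (suc m) h h′ = begin
  h 0 + h′ 0 + ∑[ j < m ] (h (suc j) + h′ (suc j))         ≡⟨ cong (h 0 + h′ 0 +_) (∑-distrib-+ m (h ∘ suc) (h′ ∘ suc)) ⟩
  h 0 + h′ 0 + (sumBelow m (h ∘ suc) + sumBelow m (h′ ∘ suc)) ≡⟨ +-assoc (h 0) (h′ 0) _ ⟩
  h 0 + (h′ 0 + (sumBelow m (h ∘ suc) + sumBelow m (h′ ∘ suc))) ≡⟨ cong (h 0 +_) (x∙yz≈y∙xz (h′ 0) (sumBelow m (h ∘ suc)) _) ⟩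
  h 0 + (sumBelow m (h ∘ suc) + (h′ 0 + sumBelow m (h′ ∘ suc))) ≡⟨ +-assoc (h 0) _ _ ⟨
  h 0 + sumBelow m (h ∘ suc) + (h′ 0 + sumBelow m (h′ ∘ suc))   ∎
  where open ≡-Reasoning

∑-single : ∀ m {h : ℕ → ℕ} j₀ → j₀ < m → (∀ j → j < m → j ≢ j₀ → h j ≡ 0) → sumBelow m h ≡ h j₀
∑-single (suc m) {h} zero     _          h≡0 =
  trans (cong (h 0 +_) (∑-zero m (λ j j<m → h≡0 (suc j) (s≤s j<m) (λ ())))) (+-identityʳ (h 0))
∑-single (suc m) {h} (suc j₀) (s≤s j₀<m) h≡0 =
  cong₂ _+_ (h≡0 0 (s≤s z≤n) (λ ())) (∑-single m j₀ j₀<m (λ j j<m j≢j₀ → h≡0 (suc j) (s≤s j<m) (j≢j₀ ∘ cong pred)))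

∑-split : ∀ m l (h : ℕ → ℕ) → sumBelow (m + l) h ≡ sumBelow m h + ∑[ i < l ] h (m + i)
∑-split zero    l h = refl
∑-split (suc m) l h = trans (cong (h 0 +_) (∑-split m l (h ∘ suc))) (sym (+-assoc (h 0) _ _))

module _ {P : Pred A ℓ} (P? : Decidable P) (f : A → ℕ) where

  private
    P∧f≡? : ∀ j → Decidable (λ x → P x × f x ≡ j)
    P∧f≡? j x = P? x ×-dec (f x ≟ j)

  count-split : ∀ m xs → (∀ {x} → x ∈ xs → f x < m) → count P? xs ≡ ∑[ j < m ] count (P∧f≡? j) xs
  count-split m []       _   = sym (∑-zero m (λ _ _ → refl))
  count-split m (x ∷ xs) f<m = begin
    count P? (x ∷ xs)                                         ≡⟨ count-++ P? [ x ] xs ⟩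
    count P? [ x ] + count P? xs                              ≡⟨ cong₂ _+_ singleton (count-split m xs (f<m ∘ there)) ⟩
    ∑[ j < m ] count (P∧f≡? j) [ x ] + ∑[ j < m ] count (P∧f≡? j) xs ≡⟨ ∑-distrib-+ m _ _ ⟨
    ∑[ j < m ] (count (P∧f≡? j) [ x ] + count (P∧f≡? j) xs)  ≡⟨ ∑-cong m (λ j _ → count-++ (P∧f≡? j) [ x ] xs) ⟨
    ∑[ j < m ] count (P∧f≡? j) (x ∷ xs)                       ∎
    where
    open ≡-Reasoning
    singleton : count P? [ x ] ≡ ∑[ j < m ] count (P∧f≡? j) [ x ]
    singleton = sym (trans
      (∑-single m {λ j → count (P∧f≡? j) [ x ]} (f x) (f<m (here refl)) (λ j _ j≢fx → count-none (P∧f≡? j) {[ x ]} (λ { (here refl) → j≢fx ∘ sym ∘ proj₂ })))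
      (count-cong (P∧f≡? (f x)) P? [ x ] (λ _ → proj₁) (λ { (here refl) px → px , refl })))

-- Sublists and the patterns 21 and 321

length-take-≤ : ∀ k (xs : List A) → k ≤ length xs → length (take k xs) ≡ k
length-take-≤ k xs k≤n = trans (length-take k xs) (m≤n⇒m⊓n≡m k≤n)

take-take-≤ : ∀ {j k} → j ≤ k → (xs : List A) → take j (take k xs) ≡ take j xs
take-take-≤ {j = j} {k = k} j≤k xs = trans (take-take j k xs) (cong (λ i → take i xs) (m≤n⇒m⊓n≡m j≤k))

Unique-⊆ : ∀ {xs ys : List A} → xs ⊆ ys → Unique ys → Unique xs
Unique-⊆ []         []               = []
Unique-⊆ (_ ∷ʳ p)   (_ ∷ u)          = Unique-⊆ p u
Unique-⊆ (refl ∷ p) (x∉ys ∷ u)       = All.tabulate (All.lookup x∉ys ∘ ∈-⊆ p) ∷ Unique-⊆ p u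

Unique-map⁺-local : (f : A → B) → ∀ {xs} → (∀ {x y} → x ∈ xs → y ∈ xs → f x ≡ f y → x ≡ y) → Unique xs → Unique (map f xs)
Unique-map⁺-local f         injective []          = []
Unique-map⁺-local f {x ∷ xs} injective (x∉xs ∷ u) =
  All.map⁺ (All.tabulate (λ y∈xs fx≡fy → All.lookup x∉xs y∈xs (injective (here refl) (there y∈xs) fx≡fy)))
  ∷ Unique-map⁺-local f (λ p q → injective (there p) (there q)) u

⊆-map⁻ : (f : A → B) → ∀ {ys} xs → ys ⊆ map f xs → Σ (List A) λ zs → zs ⊆ xs × map f zs ≡ ys
⊆-map⁻ f []       []        = [] , [] , refl
⊆-map⁻ f (x ∷ xs) (_ ∷ʳ p)  with ⊆-map⁻ f xs p
... | zs , zs⊆xs , refl = zs , x ∷ʳ zs⊆xs , refl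
⊆-map⁻ f (x ∷ xs) (refl ∷ p) with ⊆-map⁻ f xs p
... | zs , zs⊆xs , refl = x ∷ zs , refl ∷ zs⊆xs , refl

⊆-middle⁻ : ∀ {ps} (as : List A) {c} bs → ps ⊆ as ++ c ∷ bs →
            ps ⊆ as ++ bs ⊎ Σ (List A) λ p₁ → Σ (List A) λ p₂ → ps ≡ p₁ ++ c ∷ p₂ × p₁ ⊆ as × p₂ ⊆ bs
⊆-middle⁻ []       bs (_ ∷ʳ p)   = inj₁ p
⊆-middle⁻ []       bs (refl ∷ p) = inj₂ ([] , _ , refl , [] , p)
⊆-middle⁻ (a ∷ as) bs (_ ∷ʳ p)   with ⊆-middle⁻ as bs p
... | inj₁ q                          = inj₁ (a ∷ʳ q)
... | inj₂ (p₁ , p₂ , refl , q₁ , q₂) = inj₂ (p₁ , p₂ , refl , a ∷ʳ q₁ , q₂)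
⊆-middle⁻ (a ∷ as) bs (refl ∷ p) with ⊆-middle⁻ as bs p
... | inj₁ q                          = inj₁ (refl ∷ q)
... | inj₂ (p₁ , p₂ , refl , q₁ , q₂) = inj₂ (a ∷ p₁ , p₂ , refl , refl ∷ q₁ , q₂)

Contains21 : List ℕ → Set
Contains21 xs = Σ ℕ λ x → Σ ℕ λ y → y < x × x ∷ y ∷ [] ⊆ xs

Contains321 : List ℕ → Set
Contains321 xs = Σ ℕ λ x → Σ ℕ λ y → Σ ℕ λ z → y < x × z < y × x ∷ y ∷ z ∷ [] ⊆ xs

Contains21-⊆ : ∀ {xs ys} → xs ⊆ ys → Contains21 xs → Contains21 ys
Contains21-⊆ xs⊆ys (x , y , y<x , p) = x , y , y<x , ⊆-trans p xs⊆ys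

Contains321-⊆ : ∀ {xs ys} → xs ⊆ ys → Contains321 xs → Contains321 ys
Contains321-⊆ xs⊆ys (x , y , z , y<x , z<y , p) = x , y , z , y<x , z<y , ⊆-trans p xs⊆ys

module _ (f : ℕ → ℕ) where

  Contains21-map⁻ : (∀ {x y} → f x < f y → x < y) → ∀ xs → Contains21 (map f xs) → Contains21 xs
  Contains21-map⁻ reflects xs (_ , _ , lt , p) with ⊆-map⁻ f xs p
  ... | x ∷ y ∷ [] , q , refl = x , y , reflects lt , q

  Contains321-map⁻ : (∀ {x y} → f x < f y → x < y) → ∀ xs → Contains321 (map f xs) → Contains321 xs
  Contains321-map⁻ reflects xs (_ , _ , _ , lt₁ , lt₂ , p) with ⊆-map⁻ f xs p
  ... | x ∷ y ∷ z ∷ [] , q , refl = x , y , z , reflects lt₁ , reflects lt₂ , q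

  Contains21-map⁺ : ∀ xs → (∀ {x y} → x ∈ xs → y ∈ xs → x < y → f x < f y) → Contains21 xs → Contains21 (map f xs)
  Contains21-map⁺ xs mono (x , y , y<x , p) =
    f x , f y , mono (∈-⊆ p (there (here refl))) (∈-⊆ p (here refl)) y<x , map⁺ f p

  Contains321-map⁺ : (∀ {x y} → x < y → f x < f y) → ∀ {xs} → Contains321 xs → Contains321 (map f xs)
  Contains321-map⁺ mono (x , y , z , y<x , z<y , p) = f x , f y , f z , mono y<x , mono z<y , map⁺ f p

Contains21-∷⁻ : ∀ {x xs} → Contains21 (x ∷ xs) → Any (_< x) xs ⊎ Contains21 xs
Contains21-∷⁻ (_ , _ , y<x , (_ ∷ʳ p))   = inj₂ (_ , _ , y<x , p)
Contains21-∷⁻ (_ , _ , y<x , (refl ∷ p)) = inj₁ (Any.map (λ { refl → y<x }) (to∈ p))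

Contains21-∷⁺ : ∀ {x xs} → Any (_< x) xs → Contains21 (x ∷ xs)
Contains21-∷⁺ smaller with find smaller
... | y , y∈xs , y<x = _ , y , y<x , refl ∷ from∈ y∈xs

contains21? : Decidable Contains21
contains21? []       = no λ { (_ , _ , _ , ()) }
contains21? (x ∷ xs) with any? (_<? x) xs | contains21? xs
... | yes smaller | _       = yes (Contains21-∷⁺ smaller)
... | no _        | yes c   = yes (Contains21-⊆ (x ∷ʳ ⊆-refl) c)
... | no ¬smaller | no ¬c   = no ([ ¬smaller , ¬c ]′ ∘ Contains21-∷⁻)

AscendingPrefix : ℕ → List ℕ → Set
AscendingPrefix j σ = ¬ Contains21 (take j σ)

ascendingPrefix? : ∀ j → Decidable (AscendingPrefix j)
ascendingPrefix? j σ = ¬? (contains21? (take j σ))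

AscendingPrefix-mono : ∀ {j k} → j ≤ k → ∀ σ → AscendingPrefix k σ → AscendingPrefix j σ
AscendingPrefix-mono j≤k σ asc = asc ∘ Contains21-⊆ (take⁺ j≤k)

Contains21⇒2≤length : ∀ {xs} → Contains21 xs → 2 ≤ length xs
Contains21⇒2≤length (_ , _ , _ , p) = length-mono-≤ p

AscendingPrefix-≤1 : ∀ {k} σ → k ≤ 1 → AscendingPrefix k σ
AscendingPrefix-≤1 {k} σ k≤1 inv with ≤-trans (Contains21⇒2≤length inv) (≤-trans (≤-reflexive (length-take k σ)) (≤-trans (m⊓n≤m k _) k≤1))
... | s≤s ()

lookup₂-⊆ : ∀ (xs : List A) {a b : Fin (length xs)} → a <ᶠ b → lookup xs a ∷ lookup xs b ∷ [] ⊆ xs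
lookup₂-⊆ (x ∷ xs) {fzero}  {fsuc b} _         = refl ∷ from∈ (∈-lookup b)
lookup₂-⊆ (x ∷ xs) {fsuc a} {fsuc b} (s≤s a<b) = x ∷ʳ lookup₂-⊆ xs a<b

lookup₃-⊆ : ∀ (xs : List A) {a b c : Fin (length xs)} → a <ᶠ b → b <ᶠ c → lookup xs a ∷ lookup xs b ∷ lookup xs c ∷ [] ⊆ xs
lookup₃-⊆ (x ∷ xs) {fzero}  {fsuc b} {fsuc c} _         (s≤s b<c) = refl ∷ lookup₂-⊆ xs b<c
lookup₃-⊆ (x ∷ xs) {fsuc a} {fsuc b} {fsuc c} (s≤s a<b) (s≤s b<c) = x ∷ʳ lookup₃-⊆ xs a<b b<c

⊆-lookup₂ : ∀ {x y : A} xs → x ∷ y ∷ [] ⊆ xs →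
            Σ (Fin (length xs)) λ a → Σ (Fin (length xs)) λ b → a <ᶠ b × lookup xs a ≡ x × lookup xs b ≡ y
⊆-lookup₂ (_ ∷ xs) (_ ∷ʳ p) with ⊆-lookup₂ xs p
... | a , b , a<b , refl , refl = fsuc a , fsuc b , s≤s a<b , refl , refl
⊆-lookup₂ (_ ∷ xs) (refl ∷ p) = fzero , fsuc (Any.index (to∈ p)) , s≤s z≤n , refl , sym (lookup-index (to∈ p))

⊆-lookup₃ : ∀ {x y z : A} xs → x ∷ y ∷ z ∷ [] ⊆ xs →
            Σ (Fin (length xs)) λ a → Σ (Fin (length xs)) λ b → Σ (Fin (length xs)) λ c →
            a <ᶠ b × b <ᶠ c × lookup xs a ≡ x × lookup xs b ≡ y × lookup xs c ≡ z
⊆-lookup₃ (_ ∷ xs) (_ ∷ʳ p) with ⊆-lookup₃ xs p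
... | a , b , c , a<b , b<c , refl , refl , refl = fsuc a , fsuc b , fsuc c , s≤s a<b , s≤s b<c , refl , refl , refl
⊆-lookup₃ (_ ∷ xs) (refl ∷ p) with ⊆-lookup₂ xs p
... | b , c , b<c , refl , refl = fzero , fsuc b , fsuc c , s≤s z≤n , s≤s b<c , refl , refl , refl

Has321⇒Contains321 : ∀ π → Has321 π → Contains321 π
Has321⇒Contains321 π (a , b , c , a<b , b<c , lt₁ , lt₂) = _ , _ , _ , lt₁ , lt₂ , lookup₃-⊆ π a<b b<c

Contains321⇒Has321 : ∀ π → Contains321 π → Has321 π
Contains321⇒Has321 π (_ , _ , _ , lt₁ , lt₂ , p) with ⊆-lookup₃ π p
... | a , b , c , a<b , b<c , refl , refl , refl = a , b , c , a<b , b<c , lt₁ , lt₂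

HasInversion⇒Contains21 : ∀ p → HasInversion p → Contains21 p
HasInversion⇒Contains21 p (a , b , a<b , lt) = _ , _ , lt , lookup₂-⊆ p a<b

-- Flattening

AllPositive : List ℕ → Set
AllPositive σ = ∀ {x} → x ∈ σ → 1 ≤ x

rank : List ℕ → ℕ → ℕ
rank ys v = suc (count (_<? v) ys)

rank-reflects-< : ∀ ys {a b} → rank ys a < rank ys b → a < b
rank-reflects-< ys {a} {b} lt with a <? b
... | yes a<b = a<b
... | no a≮b  = ⊥-elim (<-irrefl refl (<-≤-trans lt (s≤s (count-mono (_<? b) (_<? a) (λ x<b → <-≤-trans x<b (≮⇒≥ a≮b)) ys))))

rank-strict : ∀ ys {a b} → a ∈ ys → a < b → rank ys a < rank ys b
rank-strict ys a∈ys a<b = s≤s (count-strict (_<? _) (_<? _) (λ x<a → <-trans x<a a<b) a∈ys (<-irrefl refl) a<b)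

rank-injective : ∀ ys {a b} → a ∈ ys → b ∈ ys → rank ys a ≡ rank ys b → a ≡ b
rank-injective ys {a} {b} a∈ys b∈ys eq with <-cmp a b
... | tri< a<b _ _ = ⊥-elim (<⇒≢ (rank-strict ys a∈ys a<b) eq)
... | tri≈ _ a≡b _ = a≡b
... | tri> _ _ b<a = ⊥-elim (<⇒≢ (rank-strict ys b∈ys b<a) (sym eq))

rank≤length : ∀ ys {a} → a ∈ ys → rank ys a ≤ length ys
rank≤length ys a∈ys = count<length (_<? _) a∈ys (<-irrefl refl)

rank-map-suc : ∀ zs z → rank (map suc zs) (suc z) ≡ rank zs z
rank-map-suc zs z = cong suc (trans (count-map (_<? suc z) suc zs)
  (count-cong (λ x → suc x <? suc z) (_<? z) zs (λ _ → ≤-pred) (λ _ → s≤s)))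

Contains321-flatten⁻ : ∀ ys → Contains321 (flatten ys) → Contains321 ys
Contains321-flatten⁻ ys = Contains321-map⁻ (rank ys) (rank-reflects-< ys) ys

Contains21-flatten⁻ : ∀ ys → Contains21 (flatten ys) → Contains21 ys
Contains21-flatten⁻ ys = Contains21-map⁻ (rank ys) (rank-reflects-< ys) ys

Contains21-flatten⁺ : ∀ ys → Contains21 ys → Contains21 (flatten ys)
Contains21-flatten⁺ ys = Contains21-map⁺ (rank ys) ys (λ a∈ys _ → rank-strict ys a∈ys)

flatten-map-suc : ∀ zs → flatten (map suc zs) ≡ flatten zs
flatten-map-suc zs = trans (sym (map-∘ zs)) (map-cong (rank-map-suc zs) zs)

flatten-positive : ∀ ys → AllPositive (flatten ys)
flatten-positive ys x∈ with ∈-map⁻ (rank ys) x∈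
... | _ , _ , refl = s≤s z≤n

length-prefixFlat : ∀ k π → k ≤ length π → length (prefixFlat k π) ≡ k
length-prefixFlat k π k≤n = trans (length-map _ (take k π)) (length-take-≤ k π k≤n)

AscendingPrefix-prefixFlat : ∀ {j k} σ → j ≤ k → AscendingPrefix j (prefixFlat k σ) → AscendingPrefix j σ
AscendingPrefix-prefixFlat {j} {k} σ j≤k asc =
  asc ∘ subst Contains21 (sym (take-map j (take k σ)))
      ∘ Contains21-map⁺ (rank (take k σ)) (take j (take k σ)) (λ a∈ _ → rank-strict (take k σ) (∈-⊆ (take-⊆ j _) a∈))
      ∘ subst Contains21 (sym (take-take-≤ j≤k σ))

-- Inserting a new minimum

-- The new entry 1 goes after the first j entries, i.e. to position j + 1 in the 1-indexed
-- convention of entry.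
insertOne : ℕ → List ℕ → List ℕ
insertOne zero    σ       = 1 ∷ map suc σ
insertOne (suc j) []      = 1 ∷ []
insertOne (suc j) (s ∷ σ) = suc s ∷ insertOne j σ

insertOne-split : ∀ j σ → insertOne j σ ≡ take j (map suc σ) ++ 1 ∷ drop j (map suc σ)
insertOne-split zero    σ       = refl
insertOne-split (suc j) []      = refl
insertOne-split (suc j) (s ∷ σ) = cong (suc s ∷_) (insertOne-split j σ)

length-insertOne : ∀ j σ → length (insertOne j σ) ≡ suc (length σ)
length-insertOne zero    σ       = cong suc (length-map suc σ)
length-insertOne (suc j) []      = refl
length-insertOne (suc j) (s ∷ σ) = cong suc (length-insertOne j σ)

insertOne-injective : ∀ j {σ τ} → insertOne j σ ≡ insertOne j τ → σ ≡ τ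
insertOne-injective zero                    eq = map-injective suc-injective (∷-injectiveʳ eq)
insertOne-injective (suc j) {[]}    {[]}    _  = refl
insertOne-injective (suc j) {[]}    {t ∷ τ} eq with trans (cong (pred ∘ length) eq) (length-insertOne j τ)
... | ()
insertOne-injective (suc j) {s ∷ σ} {[]}    eq with trans (cong (pred ∘ length) (sym eq)) (length-insertOne j σ)
... | ()
insertOne-injective (suc j) {s ∷ σ} {t ∷ τ} eq =
  cong₂ _∷_ (suc-injective (∷-injectiveˡ eq)) (insertOne-injective j (∷-injectiveʳ eq))

map-suc⊆insertOne : ∀ j σ → map suc σ ⊆ insertOne j σ
map-suc⊆insertOne j σ = subst₂ _⊆_ (take++drop≡id j (map suc σ)) (sym (insertOne-split j σ))
  (++⁺ ⊆-refl (1 ∷ʳ ⊆-refl))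

1∈insertOne : ∀ j σ → 1 ∈ insertOne j σ
1∈insertOne zero    σ       = here refl
1∈insertOne (suc j) []      = here refl
1∈insertOne (suc j) (s ∷ σ) = there (1∈insertOne j σ)

∈-insertOne⁻ : ∀ {x} j σ → x ∈ insertOne j σ → x ≡ 1 ⊎ Σ ℕ λ t → t ∈ σ × x ≡ suc t
∈-insertOne⁻ zero    σ       (here refl) = inj₁ refl
∈-insertOne⁻ zero    σ       (there x∈)  with ∈-map⁻ suc x∈
... | t , t∈σ , refl = inj₂ (t , t∈σ , refl)
∈-insertOne⁻ (suc j) []      (here refl) = inj₁ refl
∈-insertOne⁻ (suc j) (s ∷ σ) (here refl) = inj₂ (s , here refl , refl)
∈-insertOne⁻ (suc j) (s ∷ σ) (there x∈)  with ∈-insertOne⁻ j σ x∈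
... | inj₁ x≡1              = inj₁ x≡1
... | inj₂ (t , t∈σ , x≡1+t) = inj₂ (t , there t∈σ , x≡1+t)

Unique-insertOne⁻ : ∀ j σ → Unique (insertOne j σ) → Unique σ
Unique-insertOne⁻ j σ = Unique.map⁻ ∘ Unique-⊆ (map-suc⊆insertOne j σ)

Unique-insertOne⁺ : ∀ j σ → AllPositive σ → Unique σ → Unique (insertOne j σ)
Unique-insertOne⁺ zero    σ       pos u = All.tabulate 1∉ ∷ Unique.map⁺ suc-injective u
  where
  1∉ : ∀ {x} → x ∈ map suc σ → 1 ≢ x
  1∉ x∈ refl with ∈-map⁻ suc x∈
  ... | t , t∈σ , refl with pos t∈σ
  ...   | ()
Unique-insertOne⁺ (suc j) []      pos u = All.[] ∷ []
Unique-insertOne⁺ (suc j) (s ∷ σ) pos (s∉σ ∷ u) =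
  All.tabulate 1+s∉ ∷ Unique-insertOne⁺ j σ (pos ∘ there) u
  where
  1+s∉ : ∀ {x} → x ∈ insertOne j σ → suc s ≢ x
  1+s∉ x∈ eq with ∈-insertOne⁻ j σ x∈
  ... | inj₁ refl with eq | pos (here refl)
  ...   | refl | ()
  1+s∉ x∈ refl | inj₂ (t , t∈σ , 1+s≡1+t) = All.lookup s∉σ (subst (_∈ σ) (sym (suc-injective 1+s≡1+t)) t∈σ) refl

below1∉map-suc : ∀ {w} {xs} → w < 1 → w ∉ map suc xs
below1∉map-suc (s≤s z≤n) w∈ with ∈-map⁻ suc w∈
... | _ , _ , ()

Contains21-map-suc⁻ : ∀ xs → Contains21 (map suc xs) → Contains21 xs
Contains21-map-suc⁻ = Contains21-map⁻ suc ≤-pred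

Contains21-map-suc⁺ : ∀ xs → Contains21 xs → Contains21 (map suc xs)
Contains21-map-suc⁺ xs = Contains21-map⁺ suc xs (λ _ _ → s≤s)

-- 1 is the smallest entry, so a 321 through it ends there.
Contains321-insertOne⁻ : ∀ j σ → Contains321 (insertOne j σ) → Contains321 σ ⊎ Contains21 (take j σ)
Contains321-insertOne⁻ j σ (x , y , z , y<x , z<y , p)
  with ⊆-middle⁻ (take j (map suc σ)) (drop j (map suc σ)) (subst (_ ⊆_) (insertOne-split j σ) p)
... | inj₁ q = inj₁ (Contains321-map⁻ suc ≤-pred σ
                       (x , y , z , y<x , z<y , subst (_ ⊆_) (take++drop≡id j (map suc σ)) q))
... | inj₂ ([] , _ , refl , _ , q₂)          = ⊥-elim (below1∉map-suc y<x (subst (_ ∈_) (drop-map j σ) (∈-⊆ q₂ (here refl))))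
... | inj₂ (_ ∷ [] , _ , refl , _ , q₂)      = ⊥-elim (below1∉map-suc z<y (subst (_ ∈_) (drop-map j σ) (∈-⊆ q₂ (here refl))))
... | inj₂ (_ ∷ _ ∷ [] , [] , refl , q₁ , _) =
  inj₂ (Contains21-map-suc⁻ (take j σ) (x , y , y<x , subst (_ ⊆_) (take-map j σ) q₁))
... | inj₂ (_ ∷ _ ∷ [] , _ ∷ _ , () , _)
... | inj₂ (_ ∷ _ ∷ _ ∷ [] , _ , () , _)
... | inj₂ (_ ∷ _ ∷ _ ∷ _ ∷ _ , _ , () , _)

Contains321-insertOne⁺ : ∀ j σ → AllPositive σ → Contains321 σ ⊎ Contains21 (take j σ) → Contains321 (insertOne j σ)
Contains321-insertOne⁺ j σ pos (inj₁ c) = Contains321-⊆ (map-suc⊆insertOne j σ) (Contains321-map⁺ suc s≤s c)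
Contains321-insertOne⁺ j σ pos (inj₂ (x , y , y<x , p)) =
  suc x , suc y , 1 , s≤s y<x , s≤s (pos (∈-⊆ (⊆-trans p (take-⊆ j σ)) (there (here refl)))) ,
  subst (_ ⊆_) (sym (insertOne-split j σ))
    (++⁺ (subst (_ ⊆_) (sym (take-map j σ)) (map⁺ suc p)) (refl ∷ minimum _))

count-insertOne : {P : Pred ℕ ℓ} (P? : Decidable P) → ∀ j σ → count P? (insertOne j σ) ≡ count P? (1 ∷ map suc σ)
count-insertOne P? j σ = begin
  count P? (insertOne j σ)                                   ≡⟨ cong (count P?) (insertOne-split j σ) ⟩
  count P? (take j (map suc σ) ++ 1 ∷ drop j (map suc σ))    ≡⟨ count-middle P? (take j (map suc σ)) 1 _ ⟩
  count P? (1 ∷ take j (map suc σ) ++ drop j (map suc σ))    ≡⟨ cong (count P? ∘ (1 ∷_)) (take++drop≡id j (map suc σ)) ⟩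
  count P? (1 ∷ map suc σ)                                   ∎
  where open ≡-Reasoning

map-insertOne : ∀ (g h : ℕ → ℕ) j σ → g 1 ≡ 1 → (∀ {z} → z ∈ σ → g (suc z) ≡ suc (h z)) →
                map g (insertOne j σ) ≡ insertOne j (map h σ)
map-insertOne g h zero    σ       g1 gsuc =
  cong₂ _∷_ g1 (trans (sym (map-∘ σ)) (trans (map-cong-local (All.tabulate gsuc)) (map-∘ σ)))
map-insertOne g h (suc j) []      g1 gsuc = cong (_∷ []) g1
map-insertOne g h (suc j) (s ∷ σ) g1 gsuc = cong₂ _∷_ (gsuc (here refl)) (map-insertOne g h j σ g1 (gsuc ∘ there))

flatten-insertOne : ∀ j zs → AllPositive zs → flatten (insertOne j zs) ≡ insertOne j (flatten zs)
flatten-insertOne j zs pos = map-insertOne (rank (insertOne j zs)) (rank zs) j zs rank-1 rank-suc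
  where
  rank-1 : rank (insertOne j zs) 1 ≡ 1
  rank-1 = cong suc (trans (count-insertOne (_<? 1) j zs)
                           (count-none (_<? 1) {1 ∷ map suc zs} λ { (here refl) → <-irrefl refl
                                                                  ; (there x∈) x<1 → below1∉map-suc x<1 x∈ }))
  rank-suc : ∀ {z} → z ∈ zs → rank (insertOne j zs) (suc z) ≡ suc (rank zs z)
  rank-suc {z} z∈zs = cong suc (begin
    count (_<? suc z) (insertOne j zs)        ≡⟨ count-insertOne (_<? suc z) j zs ⟩
    count (_<? suc z) (1 ∷ map suc zs)        ≡⟨ count-accept (_<? suc z) (s≤s (pos z∈zs)) ⟩
    suc (count (_<? suc z) (map suc zs))      ≡⟨ rank-map-suc zs z ⟩
    rank zs z                                 ∎)
    where open ≡-Reasoning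

take-insertOne : ∀ j k σ → j ≤ k → take (suc k) (insertOne j σ) ≡ insertOne j (take k σ)
take-insertOne zero    k       σ       _         = cong (1 ∷_) (take-map k σ)
take-insertOne (suc j) (suc k) []      _         = refl
take-insertOne (suc j) (suc k) (s ∷ σ) (s≤s j≤k) = cong (suc s ∷_) (take-insertOne j k σ j≤k)

take-insertOne-early : ∀ j k σ → k ≤ j → j ≤ length σ → take k (insertOne j σ) ≡ map suc (take k σ)
take-insertOne-early j       zero    σ       _         _         = refl
take-insertOne-early (suc j) (suc k) (s ∷ σ) (s≤s k≤j) (s≤s j≤n) = cong (suc s ∷_) (take-insertOne-early j k σ k≤j j≤n)

prefixFlat-insertOne : ∀ j k σ → j ≤ k → AllPositive σ → prefixFlat (suc k) (insertOne j σ) ≡ insertOne j (prefixFlat k σ)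
prefixFlat-insertOne j k σ j≤k pos =
  trans (cong flatten (take-insertOne j k σ j≤k)) (flatten-insertOne j (take k σ) (pos ∘ ∈-⊆ (take-⊆ k σ)))

prefixFlat-insertOne-early : ∀ j k σ → k ≤ j → j ≤ length σ → prefixFlat k (insertOne j σ) ≡ prefixFlat k σ
prefixFlat-insertOne-early j k σ k≤j j≤n =
  trans (cong flatten (take-insertOne-early j k σ k≤j j≤n)) (flatten-map-suc (take k σ))

positionOfOne : List ℕ → ℕ
positionOfOne []       = 0
positionOfOne (x ∷ xs) with x ≟ 1
... | yes _ = 0
... | no  _ = suc (positionOfOne xs)

positionOfOne-insertOne : ∀ j σ → j ≤ length σ → AllPositive σ → positionOfOne (insertOne j σ) ≡ j
positionOfOne-insertOne zero    σ       _         _   = refl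
positionOfOne-insertOne (suc j) (s ∷ σ) (s≤s j≤n) pos with pos (here refl)
... | s≤s z≤n = cong suc (positionOfOne-insertOne j σ j≤n (pos ∘ there))

AscendingPrefix-insertOne-zero⁻ : ∀ k σ → AscendingPrefix (suc k) (insertOne 0 σ) → AscendingPrefix k σ
AscendingPrefix-insertOne-zero⁻ k σ asc =
  asc ∘ Contains21-⊆ (1 ∷ʳ ⊆-refl) ∘ subst Contains21 (sym (take-map k σ)) ∘ Contains21-map-suc⁺ (take k σ)

AscendingPrefix-insertOne-zero⁺ : ∀ k σ → AscendingPrefix k σ → AscendingPrefix (suc k) (insertOne 0 σ)
AscendingPrefix-insertOne-zero⁺ k σ asc inv with Contains21-∷⁻ inv
... | inj₁ below1 with find below1
...   | _ , w∈ , w<1 = below1∉map-suc w<1 (subst (_ ∈_) (take-map k σ) w∈)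
AscendingPrefix-insertOne-zero⁺ k σ asc inv | inj₂ inv′ =
  asc (Contains21-map-suc⁻ (take k σ) (subst Contains21 (take-map k σ) inv′))

-- Inserting 1 at position j ∈ [1, k] puts it after the larger first entry.
¬AscendingPrefix-insertOne : ∀ j k σ → 1 ≤ j → j ≤ k → j ≤ length σ → AllPositive σ → ¬ AscendingPrefix (suc k) (insertOne j σ)
¬AscendingPrefix-insertOne (suc j) (suc k) (s ∷ σ) _ (s≤s j≤k) _ pos asc =
  asc (subst Contains21 (sym (take-insertOne (suc j) (suc k) (s ∷ σ) (s≤s j≤k)))
             (suc s , 1 , s≤s (pos (here refl)) , refl ∷ from∈ (1∈insertOne j (take k σ))))

AscendingPrefix-insertOne-early : ∀ j k σ → k ≤ j → j ≤ length σ → AscendingPrefix k (insertOne j σ) ⇔ AscendingPrefix k σ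
AscendingPrefix-insertOne-early j k σ k≤j j≤n = mk⇔
  (λ asc → asc ∘ subst Contains21 (sym (take-insertOne-early j k σ k≤j j≤n)) ∘ Contains21-map-suc⁺ (take k σ))
  (λ asc → asc ∘ Contains21-map-suc⁻ (take k σ) ∘ subst Contains21 (take-insertOne-early j k σ k≤j j≤n))

entry-map-suc : ∀ σ i → suc i ≤ length σ → entry (map suc σ) (suc i) ≡ suc (entry σ (suc i))
entry-map-suc (s ∷ σ) zero    _         = refl
entry-map-suc (s ∷ σ) (suc i) (s≤s i<n) = entry-map-suc σ i i<n

entry-insertOne-late : ∀ j k σ → j < k → k ≤ length σ → entry (insertOne j σ) (suc k) ≡ suc (entry σ k)
entry-insertOne-late zero    (suc k)       σ       _         k≤n       = entry-map-suc σ k k≤n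
entry-insertOne-late (suc j) (suc (suc k)) (s ∷ σ) (s≤s j<k) (s≤s k≤n) = entry-insertOne-late j (suc k) σ j<k k≤n

entry-insertOne-one : ∀ j σ → j ≤ length σ → entry (insertOne j σ) (suc j) ≡ 1
entry-insertOne-one zero    σ       _         = refl
entry-insertOne-one (suc j) (s ∷ σ) (s≤s j≤n) = entry-insertOne-one j σ j≤n

entry-zero : ∀ σ → entry σ 0 ≡ 0
entry-zero []      = refl
entry-zero (_ ∷ _) = refl

entry-insertOne-zero : ∀ k σ → k ≤ length σ → entry (insertOne 0 σ) (suc k) ≡ suc (entry σ k)
entry-insertOne-zero zero    σ _   = cong suc (sym (entry-zero σ))
entry-insertOne-zero (suc k) σ k≤n = entry-insertOne-late 0 (suc k) σ (s≤s z≤n) k≤n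

entry-insertOne-early : ∀ j k σ → suc k ≤ j → j ≤ length σ → entry (insertOne j σ) (suc k) ≡ suc (entry σ (suc k))
entry-insertOne-early (suc j) zero    (s ∷ σ) _         _         = refl
entry-insertOne-early (suc j) (suc k) (s ∷ σ) (s≤s k<j) (s≤s j≤n) = entry-insertOne-early j k σ k<j j≤n

entry∈take : ∀ i j σ → suc i ≤ j → j ≤ length σ → entry σ (suc i) ∈ take j σ
entry∈take zero    (suc j) (s ∷ σ) _         _         = here refl
entry∈take (suc i) (suc j) (s ∷ σ) (s≤s i<j) (s≤s j≤n) = there (entry∈take i j σ i<j j≤n)

entries⊆take : ∀ i j σ → suc (suc i) ≤ j → j ≤ length σ → entry σ (suc i) ∷ entry σ (suc (suc i)) ∷ [] ⊆ take j σ
entries⊆take zero    (suc j) (s ∷ σ) (s≤s i<j) (s≤s j≤n) = refl ∷ from∈ (entry∈take zero j σ i<j j≤n)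
entries⊆take (suc i) (suc j) (s ∷ σ) (s≤s i<j) (s≤s j≤n) = s ∷ʳ entries⊆take i j σ i<j j≤n

insertOne-of-1∈ : ∀ π → Unique π → AllPositive π → 1 ∈ π →
                  Σ ℕ λ j → Σ (List ℕ) λ σ → π ≡ insertOne j σ × j ≤ length σ × AllPositive σ
insertOne-of-1∈ (x ∷ π) (1∉π ∷ _) pos (here refl) =
  0 , map pred π , cong (1 ∷_) (sym (trans (sym (map-∘ π)) (map-id-local (All.tabulate (suc∘pred ∘ ≥2))))) , z≤n , pos′
  where
  ≥2 : ∀ {y} → y ∈ π → 2 ≤ y
  ≥2 y∈π with pos (there y∈π) | All.lookup 1∉π y∈π
  ... | s≤s {n = zero}  z≤n | 1≢1 = ⊥-elim (1≢1 refl)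
  ... | s≤s {n = suc _} z≤n | _   = s≤s (s≤s z≤n)
  suc∘pred : ∀ {y} → 2 ≤ y → suc (pred y) ≡ y
  suc∘pred (s≤s _) = refl
  pos′ : AllPositive (map pred π)
  pos′ y∈ with ∈-map⁻ pred y∈
  ... | y , y∈π , refl with ≥2 y∈π
  ...   | s≤s 1≤pred-y = 1≤pred-y
insertOne-of-1∈ (x ∷ π) (x∉π ∷ u) pos (there 1∈π) with insertOne-of-1∈ π u (pos ∘ there) 1∈π | pos (here refl)
... | j , σ , refl , j≤n , posσ | s≤s {n = zero}  z≤n = ⊥-elim (All.lookup x∉π 1∈π refl)
... | j , σ , refl , j≤n , posσ | s≤s {n = suc s} z≤n =
  suc j , suc s ∷ σ , refl , s≤s j≤n , λ { (here refl) → s≤s z≤n ; (there y∈) → posσ y∈ }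

-- Permutations and the list Av

Bounded : ℕ → List ℕ → Set
Bounded m w = ∀ {x} → x ∈ w → 1 ≤ x × x ≤ m

range-∈⁻ : ∀ {m x} → x ∈ range m → 1 ≤ x × x ≤ m
range-∈⁻ x∈ with ∈-map⁻ suc x∈
... | _ , i∈ , refl = s≤s z≤n , ∈-upTo⁻ i∈

range-∈⁺ : ∀ {m x} → 1 ≤ x → x ≤ m → x ∈ range m
range-∈⁺ (s≤s _) x≤m = ∈-map⁺ suc (∈-upTo⁺ x≤m)

range-unique : ∀ m → Unique (range m)
range-unique m = Unique.map⁺ suc-injective (Unique.upTo⁺ m)

length-range : ∀ m → length (range m) ≡ m
length-range m = trans (length-map suc (upTo m)) (length-upTo m)

range-suc : ∀ m → range (suc m) ≡ 1 ∷ map suc (range m)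
range-suc m = cong (1 ∷_) (cong (map suc) (sym (map-applyUpTo id suc m)))

words-∈⁺ : ∀ m w → Bounded m w → w ∈ words m (length w)
words-∈⁺ m []      _  = here refl
words-∈⁺ m (x ∷ w) bd = ∈-concatMap⁺ (λ w → map (_∷ w) (range m)) (Any.map (λ { refl → ∈-map⁺ (_∷ w) (uncurry range-∈⁺ (bd (here refl))) })
                                               (words-∈⁺ m w (bd ∘ there)))

words-∈⁻ : ∀ m n {w} → w ∈ words m n → length w ≡ n × Bounded m w
words-∈⁻ m zero    (here refl) = refl , λ ()
words-∈⁻ m (suc n) w∈ with find (∈-concatMap⁻ (λ w → map (_∷ w) (range m)) {xs = words m n} w∈)
... | w , w∈words , x∷w∈ with ∈-map⁻ (_∷ w) x∷w∈
... | x , x∈range , refl with words-∈⁻ m n w∈words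
... | length≡n , bd = cong suc length≡n , λ { (here refl) → range-∈⁻ x∈range ; (there y∈) → bd y∈ }

words-unique : ∀ m n → Unique (words m n)
words-unique m zero    = All.[] ∷ []
words-unique m (suc n) =
  Unique.concat⁺ (All.map⁺ (All.universal (λ w → Unique.map⁺ ∷-injectiveˡ (range-unique m)) (words m n)))
                 (AllPairs.map⁺ (AllPairs.map disjoint (words-unique m n)))
  where
  disjoint : ∀ {w w′} → w ≢ w′ → Disjoint (map (_∷ w) (range m)) (map (_∷ w′) (range m))
  disjoint w≢w′ (v∈ , v∈′) with ∈-map⁻ _ v∈ | ∈-map⁻ _ v∈′
  ... | _ , _ , refl | _ , _ , eq = w≢w′ (∷-injectiveʳ eq)

record IsPermutation (m : ℕ) (π : List ℕ) : Set where
  field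
    unique  : Unique π
    length≡ : length π ≡ m
    bounded : Bounded m π

  positive : AllPositive π
  positive = proj₁ ∘ bounded

record Is321Avoiding (m : ℕ) (π : List ℕ) : Set where
  field
    isPermutation : IsPermutation m π
    avoids321     : ¬ Contains321 π

open IsPermutation
open Is321Avoiding

Av-unique : ∀ m → Unique (Av m)
Av-unique m = Unique.filter⁺ _ (words-unique m m)

∈-Av⁺ : ∀ {m π} → Is321Avoiding m π → π ∈ Av m
∈-Av⁺ {m} {π} av = ∈-filter⁺ (λ π → isPerm? π ×-dec ¬? (has321? π))
  (subst (λ n → π ∈ words m n) (length≡ (isPermutation av)) (words-∈⁺ m π (bounded (isPermutation av))))
  (unique (isPermutation av) , avoids321 av ∘ Has321⇒Contains321 π)

∈-Av⁻ : ∀ {m π} → π ∈ Av m → Is321Avoiding m π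
∈-Av⁻ {m} {π} π∈ with ∈-filter⁻ (λ π → isPerm? π ×-dec ¬? (has321? π)) {xs = words m m} π∈
... | π∈words , u , ¬has321 with words-∈⁻ m m π∈words
... | length≡m , bd = record
  { isPermutation = record { unique = u ; length≡ = length≡m ; bounded = bd }
  ; avoids321     = ¬has321 ∘ Contains321⇒Has321 π
  }

∈-permutation : ∀ {m q} → IsPermutation m q → ∀ {y} → 1 ≤ y → y ≤ m → y ∈ q
∈-permutation {m} {q} perm {y} 1≤y y≤m with y ∈? q
... | yes y∈q = y∈q
... | no  y∉q = ⊥-elim (<-irrefl refl (begin-strict
  m                                  ≡⟨ length≡ perm ⟨
  length q                           ≤⟨ length-≤-injection id q others (unique perm) q⊆others (λ _ _ → id) ⟩
  length others                      <⟨ count<length (λ x → ¬? (x ≟ y)) (range-∈⁺ 1≤y y≤m) (λ y≢y → y≢y refl) ⟩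
  length (range m)                   ≡⟨ length-range m ⟩
  m                                  ∎))
  where
  open ≤-Reasoning
  others = filter (λ x → ¬? (x ≟ y)) (range m)
  q⊆others : ∀ {z} → z ∈ q → z ∈ others
  q⊆others z∈q = ∈-filter⁺ (λ x → ¬? (x ≟ y)) (uncurry range-∈⁺ (bounded perm z∈q)) (λ { refl → y∉q z∈q })

-- The entries of q below x are exactly 1, …, x ∸ 1.
flatten-permutation : ∀ {m q} → IsPermutation m q → flatten q ≡ q
flatten-permutation {m} {q} perm = map-id-local (All.tabulate rank≡)
  where
  rank≡ : ∀ {x} → x ∈ q → rank q x ≡ x
  rank≡ {suc x} x∈q = cong suc (≤-antisym
    (subst (count (_<? suc x) q ≤_) (length-range x)
      (length-≤-injection id (filter (_<? suc x) q) (range x) (Unique.filter⁺ _ (unique perm)) below⁻ (λ _ _ → id)))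
    (subst (_≤ count (_<? suc x) q) (length-range x)
      (length-≤-injection id (range x) (filter (_<? suc x) q) (range-unique x) below⁺ (λ _ _ → id))))
    where
    below⁻ : ∀ {z} → z ∈ filter (_<? suc x) q → z ∈ range x
    below⁻ z∈ with ∈-filter⁻ (_<? suc x) z∈
    ... | z∈q , s≤s z≤x = range-∈⁺ (proj₁ (bounded perm z∈q)) z≤x
    below⁺ : ∀ {z} → z ∈ range x → z ∈ filter (_<? suc x) q
    below⁺ z∈ with range-∈⁻ z∈
    ... | 1≤z , z≤x = ∈-filter⁺ (_<? suc x) (∈-permutation perm 1≤z (≤-trans z≤x (≤-trans (n≤1+n x) (proj₂ (bounded perm x∈q))))) (s≤s z≤x)
  rank≡ {zero} x∈q with proj₁ (bounded perm x∈q)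
  ... | ()

flatten-isPermutation : ∀ ys → Unique ys → IsPermutation (length ys) (flatten ys)
flatten-isPermutation ys u = record
  { unique  = Unique-map⁺-local (rank ys) (rank-injective ys) u
  ; length≡ = length-map (rank ys) ys
  ; bounded = λ x∈ → let (y , y∈ys , x≡) = ∈-map⁻ (rank ys) x∈ in subst (λ x → 1 ≤ x × x ≤ length ys) (sym x≡) (s≤s z≤n , rank≤length ys y∈ys)
  }

filter≢1-insertOne : ∀ j q → AllPositive q → filter (λ x → ¬? (x ≟ 1)) (insertOne j q) ≡ map suc q
filter≢1-insertOne zero    []      pos = refl
filter≢1-insertOne zero    (t ∷ q) pos with pos (here refl)
... | s≤s z≤n = cong (suc t ∷_) (filter≢1-insertOne zero q (pos ∘ there))
filter≢1-insertOne (suc j) []      pos = refl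
filter≢1-insertOne (suc j) (t ∷ q) pos with pos (here refl)
... | s≤s z≤n = cong (suc t ∷_) (filter≢1-insertOne j q (pos ∘ there))

removeOne-insertOne : ∀ {m q} j → IsPermutation m q → removeOne (insertOne j q) ≡ q
removeOne-insertOne {q = q} j perm =
  trans (cong flatten (filter≢1-insertOne j q (positive perm))) (trans (flatten-map-suc q) (flatten-permutation perm))

flatten-ascending : ∀ ys → Unique ys → ¬ Contains21 ys → flatten ys ≡ range (length ys)
flatten-ascending []       _          _       = refl
flatten-ascending (y ∷ ys) (y∉ys ∷ u) ¬inv = trans (cong₂ _∷_ rank-y rank-rest) (sym (range-suc (length ys)))
  where
  y<z : ∀ {z} → z ∈ ys → y < z
  y<z {z} z∈ys with <-cmp y z
  ... | tri< y<z _ _ = y<z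
  ... | tri≈ _ y≡z _ = ⊥-elim (All.lookup y∉ys z∈ys y≡z)
  ... | tri> _ _ z<y = ⊥-elim (¬inv (y , z , z<y , refl ∷ from∈ z∈ys))
  rank-y : rank (y ∷ ys) y ≡ 1
  rank-y = cong suc (count-none (_<? y) {y ∷ ys} λ { (here refl) → <-irrefl refl ; (there z∈) z<y → <-irrefl refl (<-trans z<y (y<z z∈)) })
  rank-rest : map (rank (y ∷ ys)) ys ≡ map suc (range (length ys))
  rank-rest = begin
    map (rank (y ∷ ys)) ys    ≡⟨ map-cong-local (All.tabulate (λ z∈ → cong suc (count-accept (_<? _) (y<z z∈)))) ⟩
    map (suc ∘ rank ys) ys    ≡⟨ map-∘ ys ⟩
    map suc (flatten ys)      ≡⟨ cong (map suc) (flatten-ascending ys u (¬inv ∘ Contains21-⊆ (y ∷ʳ ⊆-refl))) ⟩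
    map suc (range (length ys)) ∎
    where open ≡-Reasoning

range-ascending : ∀ m → ¬ Contains21 (range m)
range-ascending zero    (_ , _ , _ , ())
range-ascending (suc m) inv with Contains21-∷⁻ (subst Contains21 (range-suc m) inv)
... | inj₁ below1 with find below1
...   | _ , w∈ , w<1 = below1∉map-suc w<1 w∈
range-ascending (suc m) inv | inj₂ inv′ = range-ascending m (Contains21-map-suc⁻ (range m) inv′)

prefixFlat≡range⇒ascending : ∀ k π → prefixFlat k π ≡ range k → AscendingPrefix k π
prefixFlat≡range⇒ascending k π eq = range-ascending k ∘ subst Contains21 eq ∘ Contains21-flatten⁺ (take k π)

ascending⇒prefixFlat≡range : ∀ {N π} k → IsPermutation N π → k ≤ N → AscendingPrefix k π → prefixFlat k π ≡ range k
ascending⇒prefixFlat≡range {π = π} k perm k≤N asc =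
  trans (flatten-ascending (take k π) (Unique.take⁺ k (unique perm)) asc) (cong range (length-take-≤ k π (subst (k ≤_) (sym (length≡ perm)) k≤N)))

prefixFlat-is321Avoiding : ∀ k π → Unique π → ¬ Contains321 π → k ≤ length π → Is321Avoiding k (prefixFlat k π)
prefixFlat-is321Avoiding k π u avoids k≤n = record
  { isPermutation = subst (λ m → IsPermutation m (prefixFlat k π)) (length-take-≤ k π k≤n)
                          (flatten-isPermutation (take k π) (Unique.take⁺ k u))
  ; avoids321     = avoids ∘ Contains321-⊆ (take-⊆ k π) ∘ Contains321-flatten⁻ (take k π)
  }

≤-length-Av : ∀ n {σ j} → σ ∈ Av n → j ≤ n → j ≤ length σ
≤-length-Av n σ∈ = subst (_ ≤_) (sym (length≡ (isPermutation (∈-Av⁻ {n} σ∈))))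

positive-Av : ∀ n {σ} → σ ∈ Av n → AllPositive σ
positive-Av n σ∈ = positive (isPermutation (∈-Av⁻ {n} σ∈))

-- Decomposing Av (suc n) by the position of 1

decompose : ∀ n {π} → Is321Avoiding (suc n) π →
            Σ ℕ λ j → Σ (List ℕ) λ σ → π ≡ insertOne j σ × j ≤ n × Is321Avoiding n σ × AscendingPrefix j σ
decompose n {π} av
  with insertOne-of-1∈ π (unique (isPermutation av)) (positive (isPermutation av))
                         (∈-permutation (isPermutation av) (s≤s z≤n) (s≤s z≤n))
... | j , σ , refl , j≤len , posσ = j , σ , refl , subst (j ≤_) length≡n j≤len , avσ , avoids321 av ∘ Contains321-insertOne⁺ j σ posσ ∘ inj₂
  where
  perm = isPermutation av
  length≡n : length σ ≡ n
  length≡n = suc-injective (trans (sym (length-insertOne j σ)) (length≡ perm))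
  avσ : Is321Avoiding n σ
  avσ = record
    { isPermutation = record
      { unique  = Unique-insertOne⁻ j σ (unique perm)
      ; length≡ = length≡n
      ; bounded = λ t∈ → posσ t∈ , ≤-pred (proj₂ (bounded perm (∈-⊆ (map-suc⊆insertOne j σ) (∈-map⁺ suc t∈))))
      }
    ; avoids321 = avoids321 av ∘ Contains321-insertOne⁺ j σ posσ ∘ inj₁
    }

insertOne-is321Avoiding : ∀ {n j σ} → j ≤ n → Is321Avoiding n σ → AscendingPrefix j σ → Is321Avoiding (suc n) (insertOne j σ)
insertOne-is321Avoiding {n} {j} {σ} j≤n av asc = record
  { isPermutation = record
    { unique  = Unique-insertOne⁺ j σ (positive perm) (unique perm)
    ; length≡ = trans (length-insertOne j σ) (cong suc (length≡ perm))
    ; bounded = bounded′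
    }
  ; avoids321 = [ avoids321 av , asc ]′ ∘ Contains321-insertOne⁻ j σ
  }
  where
  perm = isPermutation av
  bounded′ : Bounded (suc n) (insertOne j σ)
  bounded′ x∈ with ∈-insertOne⁻ j σ x∈
  ... | inj₁ refl              = s≤s z≤n , s≤s z≤n
  ... | inj₂ (t , t∈σ , refl) = s≤s z≤n , s≤s (proj₂ (bounded perm t∈σ))

module _ {P : Pred (List ℕ) ℓ} (P? : Decidable P) where

  insertedAt? : ∀ j → Decidable (λ σ → P (insertOne j σ) × AscendingPrefix j σ)
  insertedAt? j σ = P? (insertOne j σ) ×-dec ascendingPrefix? j σ

  insertionCount : ℕ → ℕ → ℕ
  insertionCount n j = count (insertedAt? j) (Av n)

  -- π ↦ (position of 1 in π, removeOne π) is a bijection from Av (suc n) onto the pairs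
  -- (j , σ) with j ≤ n, σ ∈ Av n and σ ascending on its first j entries.
  count-Av-suc : ∀ n → count P? (Av (suc n)) ≡ ∑[ j < suc n ] insertionCount n j
  count-Av-suc n =
    trans (count-split P? positionOfOne (suc n) (Av (suc n)) position<)
          (∑-cong (suc n) λ j j<1+n → count-bijection (λ π → P? π ×-dec (positionOfOne π ≟ j)) (insertedAt? j) (Av-unique (suc n)) (Av-unique n) removeOne (insertOne j) (fwd j) (bwd j (≤-pred j<1+n)))
    where
    position-insertOne : ∀ {j σ} → j ≤ n → Is321Avoiding n σ → positionOfOne (insertOne j σ) ≡ j
    position-insertOne {j} {σ} j≤n av =
      positionOfOne-insertOne j σ (subst (j ≤_) (sym (length≡ (isPermutation av))) j≤n) (positive (isPermutation av))
    position< : ∀ {π} → π ∈ Av (suc n) → positionOfOne π < suc n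
    position< π∈ with decompose n (∈-Av⁻ π∈)
    ... | j , σ , refl , j≤n , av , _ = s≤s (subst (_≤ n) (sym (position-insertOne j≤n av)) j≤n)
    fwd : ∀ j {π} → π ∈ Av (suc n) → P π × positionOfOne π ≡ j →
          removeOne π ∈ Av n × (P (insertOne j (removeOne π)) × AscendingPrefix j (removeOne π)) × insertOne j (removeOne π) ≡ π
    fwd j π∈ (pπ , pos≡j) with decompose n (∈-Av⁻ π∈)
    ... | j′ , σ , refl , j′≤n , av , asc
      with trans (sym (position-insertOne j′≤n av)) pos≡j
         | removeOne-insertOne j′ (isPermutation av)
    ... | refl | removeOne≡σ rewrite removeOne≡σ = ∈-Av⁺ av , (pπ , asc) , refl
    bwd : ∀ j → j ≤ n → ∀ {σ} → σ ∈ Av n → P (insertOne j σ) × AscendingPrefix j σ →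
          insertOne j σ ∈ Av (suc n) × (P (insertOne j σ) × positionOfOne (insertOne j σ) ≡ j) × removeOne (insertOne j σ) ≡ σ
    bwd j j≤n σ∈ (p , asc) with ∈-Av⁻ σ∈
    ... | av = ∈-Av⁺ (insertOne-is321Avoiding j≤n av asc) ,
               (p , position-insertOne j≤n av) ,
               removeOne-insertOne j (isPermutation av)

-- Binomial coefficients and ballot numbers

C-absorption : ∀ n r → suc r * (suc n C suc r) ≡ suc n * (n C r)
C-absorption zero    zero    = refl
C-absorption zero    (suc r) = *-zeroʳ (suc (suc r))
C-absorption (suc n) zero    = trans (+-identityʳ _) (trans (nC1≡n (suc (suc n))) (sym (*-identityʳ (suc (suc n)))))
C-absorption (suc n) (suc r) = begin
  suc (suc r) * (suc (suc n) C suc (suc r))    ≡⟨ cong (suc (suc r) *_) (nCk+nC[k+1]≡[n+1]C[k+1] (suc n) (suc r)) ⟨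
  suc (suc r) * (X + Y)                        ≡⟨ expand r X Y ⟩
  X + suc r * X + suc (suc r) * Y              ≡⟨ cong₂ (λ a b → X + a + b) (C-absorption n r) (C-absorption n (suc r)) ⟩
  X + suc n * (n C r) + suc n * (n C suc r)    ≡⟨ +-assoc X _ _ ⟩
  X + (suc n * (n C r) + suc n * (n C suc r))  ≡⟨ cong (X +_) (*-distribˡ-+ (suc n) (n C r) (n C suc r)) ⟨
  X + suc n * (n C r + n C suc r)              ≡⟨ cong (λ t → X + suc n * t) (nCk+nC[k+1]≡[n+1]C[k+1] n r) ⟩
  X + suc n * X                                ∎
  where
  open ≡-Reasoning
  X = suc n C suc r
  Y = suc n C suc (suc r)
  expand : ∀ r x y → suc (suc r) * (x + y) ≡ x + suc r * x + suc (suc r) * y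
  expand = solve-∀

C-ratio : ∀ r d → suc r * ((r + d) C suc r) ≡ d * ((r + d) C r)
C-ratio r d = +-cancelˡ-≡ (suc r * X) _ _ (begin
  suc r * X + suc r * Y         ≡⟨ *-distribˡ-+ (suc r) X Y ⟨
  suc r * (X + Y)               ≡⟨ cong (suc r *_) (nCk+nC[k+1]≡[n+1]C[k+1] (r + d) r) ⟩
  suc r * (suc (r + d) C suc r) ≡⟨ C-absorption (r + d) r ⟩
  suc (r + d) * X               ≡⟨ *-distribʳ-+ X (suc r) d ⟩
  suc r * X + d * X             ∎)
  where
  open ≡-Reasoning
  X = (r + d) C r
  Y = (r + d) C suc r

module BallotStep (a k : ℕ) where

  R = suc (a + k)
  M = R + suc a
  X = M C R
  Y = M C suc R

  -- Multiplying by suc R turns both hypotheses into multiples of X, by C-ratio.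
  combine : ∀ {t u v} → t ≡ u + v → suc R * u ≡ (k + 1) * X → suc (suc R) * v ≡ (k + 3) * Y →
            suc (suc R) * t ≡ (suc k + 1) * (suc M C suc R)
  combine {t} {u} {v} t≡u+v u-formula v-formula = *-cancelˡ-≡ _ _ (suc R) (begin
    suc R * (suc (suc R) * t)                             ≡⟨ cong (λ t → suc R * (suc (suc R) * t)) t≡u+v ⟩
    suc R * (suc (suc R) * (u + v))                       ≡⟨ regroup₁ (suc R) u v ⟩
    suc (suc R) * (suc R * u) + suc R * (suc (suc R) * v) ≡⟨ cong₂ (λ u v → suc (suc R) * u + suc R * v) u-formula v-formula ⟩
    suc (suc R) * ((k + 1) * X) + suc R * ((k + 3) * Y)   ≡⟨ cong (suc (suc R) * ((k + 1) * X) +_) (regroup₂ (suc R) k Y) ⟩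
    suc (suc R) * ((k + 1) * X) + (k + 3) * (suc R * Y)   ≡⟨ cong (λ t → suc (suc R) * ((k + 1) * X) + (k + 3) * t) Y-formula ⟩
    suc (suc R) * ((k + 1) * X) + (k + 3) * (suc a * X)   ≡⟨ regroup₃ a k X ⟩
    (suc k + 1) * (suc R * X) + (suc k + 1) * (suc a * X) ≡⟨ cong (λ t → (suc k + 1) * (suc R * X) + (suc k + 1) * t) Y-formula ⟨
    (suc k + 1) * (suc R * X) + (suc k + 1) * (suc R * Y) ≡⟨ regroup₄ (suc R) k X Y ⟩
    suc R * ((suc k + 1) * (X + Y))                       ≡⟨ cong (λ t → suc R * ((suc k + 1) * t)) (nCk+nC[k+1]≡[n+1]C[k+1] M R) ⟩
    suc R * ((suc k + 1) * (suc M C suc R))               ∎)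
    where
    open ≡-Reasoning
    Y-formula : suc R * Y ≡ suc a * X
    Y-formula = C-ratio R (suc a)
    regroup₁ : ∀ r u v → r * (suc r * (u + v)) ≡ suc r * (r * u) + r * (suc r * v)
    regroup₁ = solve-∀
    regroup₂ : ∀ r k y → r * ((k + 3) * y) ≡ (k + 3) * (r * y)
    regroup₂ = solve-∀
    regroup₃ : ∀ a k x → suc (suc (suc (a + k))) * ((k + 1) * x) + (k + 3) * (suc a * x)
                         ≡ (suc k + 1) * (suc (suc (a + k)) * x) + (suc k + 1) * (suc a * x)
    regroup₃ = solve-∀
    regroup₄ : ∀ r k x y → (suc k + 1) * (r * x) + (suc k + 1) * (r * y) ≡ r * ((suc k + 1) * (x + y))
    regroup₄ = solve-∀

module _ (g : ℕ → ℕ → ℕ)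
         (g-top  : ∀ k → g 0 k ≡ 1)
         (g-edge : ∀ a → g (suc a) 0 ≡ g a 1)
         (g-rec  : ∀ a k → g (suc a) (suc k) ≡ g (suc a) k + g a (suc (suc k))) where

  -- Ballot numbers in the coordinates a = n ∸ k and k: (n + 1) g ≡ (k + 1) ((2n ∸ k) C n).
  BallotAt : ℕ → ℕ → Set
  BallotAt a k = (a + k + 1) * g a k ≡ (k + 1) * ((a + a + k) C (a + k))

  ballot-edge : ∀ a → BallotAt a 1 → BallotAt (suc a) 0
  ballot-edge a ih = begin
    (suc a + 0 + 1) * g (suc a) 0            ≡⟨ cong₂ _*_ (reassociate a) (g-edge a) ⟩
    (a + 1 + 1) * g a 1                      ≡⟨ ih ⟩
    2 * ((a + a + 1) C (a + 1))              ≡⟨ cong₂ (λ m r → 2 * (m C r)) (middle a) (+-comm a 1) ⟩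
    2 * Y                                    ≡⟨ double Y ⟩
    Y + Y                                    ≡⟨ cong (_+ Y) Y≡X ⟩
    X + Y                                    ≡⟨ nCk+nC[k+1]≡[n+1]C[k+1] M a ⟩
    suc M C suc a                            ≡⟨ *-identityˡ _ ⟨
    1 * (suc M C suc a)                      ≡⟨ cong₂ (λ m r → 1 * (m C r)) (top a) (sym (+-identityʳ (suc a))) ⟩
    (0 + 1) * ((suc a + suc a + 0) C (suc a + 0)) ∎
    where
    open ≡-Reasoning
    M = a + suc a
    X = M C a
    Y = M C suc a
    Y≡X : Y ≡ X
    Y≡X = *-cancelˡ-≡ Y X (suc a) (C-ratio a (suc a))
    reassociate : ∀ a → suc a + 0 + 1 ≡ a + 1 + 1
    reassociate = solve-∀
    middle : ∀ a → a + a + 1 ≡ a + suc a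
    middle = solve-∀
    double : ∀ y → 2 * y ≡ y + y
    double = solve-∀
    top : ∀ a → suc (a + suc a) ≡ suc a + suc a + 0
    top = solve-∀

  ballot-step : ∀ a k → BallotAt (suc a) k → BallotAt a (suc (suc k)) → BallotAt (suc a) (suc k)
  ballot-step a k ih₁ ih₂ = begin
    (suc a + suc k + 1) * g (suc a) (suc k)                    ≡⟨ cong (_* g (suc a) (suc k)) (T-size a k) ⟩
    suc (suc R) * g (suc a) (suc k)                            ≡⟨ combine {u = g (suc a) k} {v = g a (suc (suc k))} (g-rec a k) U-formula V-formula ⟩
    (suc k + 1) * (suc M C suc R)                              ≡⟨ cong₂ (λ m r → (suc k + 1) * (m C r)) (T-top a k) (T-bottom a k) ⟩
    (suc k + 1) * ((suc a + suc a + suc k) C (suc a + suc k))  ∎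
    where
    open ≡-Reasoning
    open BallotStep a k
    T-size : ∀ a k → suc a + suc k + 1 ≡ suc (suc (suc (a + k)))
    T-size = solve-∀
    T-top : ∀ a k → suc (suc (a + k) + suc a) ≡ suc a + suc a + suc k
    T-top = solve-∀
    T-bottom : ∀ a k → suc (suc (a + k)) ≡ suc a + suc k
    T-bottom = solve-∀
    U-size : ∀ a k → suc a + k + 1 ≡ suc (suc (a + k))
    U-size = solve-∀
    U-top : ∀ a k → suc a + suc a + k ≡ suc (a + k) + suc a
    U-top = solve-∀
    V-size : ∀ a k → a + suc (suc k) + 1 ≡ suc (suc (suc (a + k)))
    V-size = solve-∀
    V-factor : ∀ k → suc (suc k) + 1 ≡ k + 3
    V-factor = solve-∀
    V-top : ∀ a k → a + a + suc (suc k) ≡ suc (a + k) + suc a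
    V-top = solve-∀
    V-bottom : ∀ a k → a + suc (suc k) ≡ suc (suc (a + k))
    V-bottom = solve-∀
    U-formula : suc R * g (suc a) k ≡ (k + 1) * X
    U-formula = trans (cong (_* g (suc a) k) (sym (U-size a k))) (trans ih₁ (cong (λ m → (k + 1) * (m C R)) (U-top a k)))
    V-formula : suc (suc R) * g a (suc (suc k)) ≡ (k + 3) * Y
    V-formula = trans (cong (_* g a (suc (suc k))) (sym (V-size a k)))
                      (trans ih₂ (trans (cong₂ (λ c m → c * (m C (a + suc (suc k)))) (V-factor k) (V-top a k))
                                        (cong (λ r → (k + 3) * (M C r)) (V-bottom a k))))

  ballot : ∀ a k → BallotAt a k
  ballot zero    k       = cong ((k + 1) *_) (trans (g-top k) (sym (nCn≡1 k)))
  ballot (suc a) zero    = ballot-edge a (ballot a 1)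
  ballot (suc a) (suc k) = ballot-step a k (ballot (suc a) k) (ballot a (suc (suc k)))

-- Eligible prefixes with an inversion

module _ (n : ℕ) {j₀ q} (j₀≤k′ : j₀ ≤ length q) (k′≤n : length q ≤ n) (posq : AllPositive q)
         (ascq : AscendingPrefix j₀ q) (inv : Contains21 (insertOne j₀ q)) where

  private
    k′ = length q
    p  = insertOne j₀ q

  module _ {P : Pred (List ℕ) ℓ} {Q : Pred (List ℕ) ℓ′} (P? : Decidable P) (Q? : Decidable Q)
           (P⇒prefix : ∀ {π} → P π → prefixFlat (suc k′) π ≡ p)
           (Q⇒prefix : ∀ {σ} → Q σ → prefixFlat k′ σ ≡ q)
           (P⇒Q : ∀ {σ} → Is321Avoiding n σ → P (insertOne j₀ σ) → Q σ)
           (Q⇒P : ∀ {σ} → Is321Avoiding n σ → Q σ → P (insertOne j₀ σ)) where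

    -- The prefix p already fixes where 1 was inserted: before position k′ its position is
    -- read off p, and after it the inversion of p would break the ascending prefix of σ.
    insertion-position : ∀ {j σ} → j ≤ n → Is321Avoiding n σ → P (insertOne j σ) → AscendingPrefix j σ → j ≡ j₀
    insertion-position {j} {σ} j≤n av pπ asc with j ≤? k′
    ... | yes j≤k′ = begin
      j                                           ≡⟨ positionOfOne-insertOne j (prefixFlat k′ σ) j≤length (flatten-positive _) ⟨
      positionOfOne (insertOne j (prefixFlat k′ σ)) ≡⟨ cong positionOfOne (trans (sym (prefixFlat-insertOne j k′ σ j≤k′ (positive perm))) (P⇒prefix pπ)) ⟩
      positionOfOne p                              ≡⟨ positionOfOne-insertOne j₀ q j₀≤k′ posq ⟩
      j₀                                           ∎
      where
      open ≡-Reasoning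
      perm = isPermutation av
      j≤length : j ≤ length (prefixFlat k′ σ)
      j≤length = subst (j ≤_) (sym (length-prefixFlat k′ σ (subst (k′ ≤_) (sym (length≡ perm)) k′≤n))) j≤k′
    ... | no j≰k′ = ⊥-elim (asc (Contains21-⊆ (take⁺ k′<j) (Contains21-flatten⁻ (take (suc k′) σ) (subst Contains21 p≡ inv))))
      where
      k′<j = ≰⇒> j≰k′
      p≡ : p ≡ prefixFlat (suc k′) σ
      p≡ = trans (sym (P⇒prefix pπ)) (prefixFlat-insertOne-early j (suc k′) σ k′<j (subst (j ≤_) (sym (length≡ (isPermutation av))) j≤n))

    count-Av-prefix : count P? (Av (suc n)) ≡ count Q? (Av n)
    count-Av-prefix = begin
      count P? (Av (suc n))                    ≡⟨ count-Av-suc P? n ⟩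
      ∑[ j < suc n ] insertionCount P? n j    ≡⟨ ∑-single (suc n) j₀ (s≤s (≤-trans j₀≤k′ k′≤n)) other-zero ⟩
      insertionCount P? n j₀                  ≡⟨ count-cong _ Q? (Av n) (λ σ∈ → P⇒Q (∈-Av⁻ σ∈) ∘ proj₁) (λ σ∈ qσ → Q⇒P (∈-Av⁻ σ∈) qσ , ascending qσ) ⟩
      count Q? (Av n)                          ∎
      where
      open ≡-Reasoning
      other-zero : ∀ j → j < suc n → j ≢ j₀ → insertionCount P? n j ≡ 0
      other-zero j (s≤s j≤n) j≢j₀ = count-none (insertedAt? P? j) {Av n} λ σ∈ (pπ , asc) → j≢j₀ (insertion-position j≤n (∈-Av⁻ σ∈) pπ asc)
      ascending : ∀ {σ} → Q σ → AscendingPrefix j₀ σ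
      ascending {σ} qσ = AscendingPrefix-prefixFlat σ j₀≤k′ (subst (AscendingPrefix j₀) (sym (Q⇒prefix qσ)) ascq)

S-insertOne : ∀ n {j₀ q} → j₀ < length q → length q ≤ n → AllPositive q → AscendingPrefix j₀ q →
              Contains21 (insertOne j₀ q) → S (suc n) (insertOne j₀ q) ≡ S n q
S-insertOne n {j₀} {q} j₀<k′ k′≤n posq ascq inv rewrite length-insertOne j₀ q =
  cong₂ _,_ (count-Av-prefix n j₀≤k′ k′≤n posq ascq inv _ _ proj₁ proj₁
                             (λ av → Product.map (prefix⇒ av) (entry⇒ av)) (λ av → Product.map (prefix⇐ av) (entry⇐ av)))
            (count-Av-prefix n j₀≤k′ k′≤n posq ascq inv _ _ id id prefix⇒ prefix⇐)
  where
  k′ = length q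
  j₀≤k′ = <⇒≤ j₀<k′
  k′≤length : ∀ {σ} → Is321Avoiding n σ → k′ ≤ length σ
  k′≤length av = subst (k′ ≤_) (sym (length≡ (isPermutation av))) k′≤n
  prefix⇒ : ∀ {σ} → Is321Avoiding n σ → prefixFlat (suc k′) (insertOne j₀ σ) ≡ insertOne j₀ q → prefixFlat k′ σ ≡ q
  prefix⇒ {σ} av eq = insertOne-injective j₀ (trans (sym (prefixFlat-insertOne j₀ k′ σ j₀≤k′ (positive (isPermutation av)))) eq)
  prefix⇐ : ∀ {σ} → Is321Avoiding n σ → prefixFlat k′ σ ≡ q → prefixFlat (suc k′) (insertOne j₀ σ) ≡ insertOne j₀ q
  prefix⇐ {σ} av eq = trans (prefixFlat-insertOne j₀ k′ σ j₀≤k′ (positive (isPermutation av))) (cong (insertOne j₀) eq)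
  entry⇒ : ∀ {σ} → Is321Avoiding n σ → entry (insertOne j₀ σ) (suc k′) ≡ suc n → entry σ k′ ≡ n
  entry⇒ {σ} av eq = suc-injective (trans (sym (entry-insertOne-late j₀ k′ σ j₀<k′ (k′≤length av))) eq)
  entry⇐ : ∀ {σ} → Is321Avoiding n σ → entry σ k′ ≡ n → entry (insertOne j₀ σ) (suc k′) ≡ suc n
  entry⇐ {σ} av eq = trans (entry-insertOne-late j₀ k′ σ j₀<k′ (k′≤length av)) (cong suc eq)

S-removeOne : ∀ n {k′ p} → Is321Avoiding (suc k′) p → k′ ≤ n → Eligible p → Contains21 p → S (suc n) p ≡ S n (removeOne p)
S-removeOne n {k′} avp k′≤n eligible inv with decompose k′ avp
... | j₀ , q , refl , j₀≤k′ , avq , ascq with length≡ (isPermutation avq)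
... | refl = begin
  S (suc n) (insertOne j₀ q)          ≡⟨ S-insertOne n j₀<k′ k′≤n (positive (isPermutation avq)) ascq inv ⟩
  S n q                               ≡⟨ cong (S n) (removeOne-insertOne j₀ (isPermutation avq)) ⟨
  S n (removeOne (insertOne j₀ q))    ∎
  where
  open ≡-Reasoning
  -- If 1 were inserted last, eligibility would force p = 1, which has no inversion.
  j₀<k′ : j₀ < length q
  j₀<k′ with m≤n⇒m<n∨m≡n j₀≤k′
  ... | inj₁ j₀<k′ = j₀<k′
  ... | inj₂ refl with subst (2 ≤_) length≡1 (Contains21⇒2≤length inv)
    where
    length≡1 : length (insertOne j₀ q) ≡ 1
    length≡1 = trans (sym eligible) (trans (cong (entry (insertOne j₀ q)) (length-insertOne j₀ q)) (entry-insertOne-one j₀ q ≤-refl))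
  ...   | s≤s ()

strike-removeOne : (N : ℕ) → 1 ≤ N → (p : List ℕ) → IsPrefix N p → Eligible p → HasInversion p →
                   S N p ≡ S (N ∸ 1) (removeOne p)
strike-removeOne (suc n) _ []       (_ , _ , (() , _) , _)
strike-removeOne (suc n) _ (x ∷ xs) (π , (u , ¬has321 , length≡N) , (_ , k≤N) , flat≡p) eligible hasInv =
  S-removeOne n (subst (Is321Avoiding _) flat≡p avoiding) (≤-pred k≤N) eligible (HasInversion⇒Contains21 _ hasInv)
  where
  avoiding = prefixFlat-is321Avoiding _ π u (¬has321 ∘ Contains321⇒Has321 π) (subst (_ ≤_) (sym length≡N) k≤N)

-- The identity prefix

idPrefixCount : ℕ → ℕ → ℕ
idPrefixCount n k = count (ascendingPrefix? k) (Av n)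

insertion-offset≤ : ∀ {n k i} → k ≤ n → i < n ∸ k → suc k + i ≤ n
insertion-offset≤ {n} {k} {i} k≤n i<n∸k = begin
  suc k + i   ≡⟨ +-suc k i ⟨
  k + suc i   ≤⟨ +-monoʳ-≤ k i<n∸k ⟩
  k + (n ∸ k) ≡⟨ m+[n∸m]≡n k≤n ⟩
  n           ∎
  where open ≤-Reasoning

idPrefixCount-step : ∀ {n k} → k ≤ n →
                     idPrefixCount (suc n) (suc k) ≡ idPrefixCount n k + ∑[ i < n ∸ k ] idPrefixCount n (suc k + i)
idPrefixCount-step {n} {k} k≤n = begin
  idPrefixCount (suc n) (suc k)                  ≡⟨ count-Av-suc (ascendingPrefix? (suc k)) n ⟩
  sumBelow (suc n) t                             ≡⟨ cong (λ m → sumBelow (suc m) t) (m+[n∸m]≡n k≤n) ⟨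
  sumBelow (suc k + (n ∸ k)) t                   ≡⟨ ∑-split (suc k) (n ∸ k) t ⟩
  sumBelow (suc k) t + ∑[ i < n ∸ k ] t (suc k + i) ≡⟨ cong₂ _+_ before-k (∑-cong (n ∸ k) after-k) ⟩
  idPrefixCount n k + ∑[ i < n ∸ k ] idPrefixCount n (suc k + i) ∎
  where
  open ≡-Reasoning
  t = insertionCount (ascendingPrefix? (suc k)) n
  before-k : sumBelow (suc k) t ≡ idPrefixCount n k
  before-k = trans (cong₂ _+_ first (∑-zero k middle)) (+-identityʳ _)
    where
    first : t 0 ≡ idPrefixCount n k
    first = count-cong (insertedAt? (ascendingPrefix? (suc k)) 0) (ascendingPrefix? k) (Av n) (λ _ → AscendingPrefix-insertOne-zero⁻ k _ ∘ proj₁)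
                                  (λ {σ} _ asc → AscendingPrefix-insertOne-zero⁺ k σ asc , AscendingPrefix-≤1 σ z≤n)
    middle : ∀ j → j < k → t (suc j) ≡ 0
    middle j j<k = count-none (insertedAt? (ascendingPrefix? (suc k)) (suc j)) {Av n} λ σ∈ (asc , _) →
      ¬AscendingPrefix-insertOne (suc j) k _ (s≤s z≤n) j<k (≤-length-Av n σ∈ (≤-trans j<k k≤n)) (positive-Av n σ∈) asc
  after-k : ∀ i → i < n ∸ k → t (suc k + i) ≡ idPrefixCount n (suc k + i)
  after-k i i<n∸k = count-cong (insertedAt? (ascendingPrefix? (suc k)) (suc k + i)) (ascendingPrefix? (suc k + i)) (Av n) (λ _ → proj₂)
    (λ σ∈ asc → Equivalence.from (AscendingPrefix-insertOne-early j (suc k) _ (s≤s (m≤m+n k i)) (≤-length-Av n σ∈ j≤n))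
                                 (AscendingPrefix-mono (s≤s (m≤m+n k i)) _ asc) , asc)
    where
    j = suc k + i
    j≤n = insertion-offset≤ k≤n i<n∸k

idPrefixCount-recurrence : ∀ {n k} → suc k ≤ n →
                           idPrefixCount (suc n) (suc k) ≡ idPrefixCount n k + idPrefixCount (suc n) (suc (suc k))
idPrefixCount-recurrence {n} {k} k<n = begin
  idPrefixCount (suc n) (suc k)                                   ≡⟨ idPrefixCount-step (<⇒≤ k<n) ⟩
  F n k + sumBelow (n ∸ k) tail                                   ≡⟨ cong (λ m → F n k + sumBelow m tail) (+-∸-assoc 1 k<n) ⟩
  F n k + (F n (suc k + 0) + ∑[ i < n ∸ suc k ] tail (suc i))       ≡⟨ cong (F n k +_) (cong₂ _+_ (cong (F n) (+-identityʳ (suc k)))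
                                                                       (∑-cong (n ∸ suc k) λ i _ → cong (F n ∘ suc) (+-suc k i))) ⟩
  F n k + (F n (suc k) + ∑[ i < n ∸ suc k ] F n (suc (suc k) + i)) ≡⟨ cong (F n k +_) (idPrefixCount-step k<n) ⟨
  F n k + idPrefixCount (suc n) (suc (suc k))                      ∎
  where
  open ≡-Reasoning
  F = idPrefixCount
  tail = λ i → F n (suc k + i)

idPrefixCount-diagonal : ∀ n → idPrefixCount n n ≡ 1
idPrefixCount-diagonal zero    = refl
idPrefixCount-diagonal (suc n) = begin
  idPrefixCount (suc n) (suc n)                                         ≡⟨ idPrefixCount-step {n} {n} ≤-refl ⟩
  idPrefixCount n n + ∑[ i < n ∸ n ] idPrefixCount n (suc n + i)        ≡⟨ cong (λ m → idPrefixCount n n + ∑[ i < m ] idPrefixCount n (suc n + i)) (n∸n≡0 n) ⟩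
  idPrefixCount n n + 0                                                 ≡⟨ +-identityʳ _ ⟩
  idPrefixCount n n                                                     ≡⟨ idPrefixCount-diagonal n ⟩
  1                                                                     ∎
  where open ≡-Reasoning

idPrefixCount-0≡1 : ∀ n → idPrefixCount n 0 ≡ idPrefixCount n 1
idPrefixCount-0≡1 n = count-cong (ascendingPrefix? 0) (ascendingPrefix? 1) (Av n) (λ {σ} _ _ → AscendingPrefix-≤1 σ ≤-refl) (λ {σ} _ _ → AscendingPrefix-≤1 σ z≤n)

idPrefixCount-closed : ∀ N k → k ≤ N → (N + 1) * idPrefixCount N k ≡ (k + 1) * ((2 * N ∸ k) C N)
idPrefixCount-closed N k k≤N =
  subst (λ n → (n + 1) * idPrefixCount n k ≡ (k + 1) * ((2 * n ∸ k) C n)) (m∸n+n≡m k≤N)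
        (trans (ballot g g-top g-edge g-rec gap k) (cong (λ m → (k + 1) * (m C (gap + k))) (sym doubled)))
  where
  gap = N ∸ k
  g : ℕ → ℕ → ℕ
  g a k = idPrefixCount (a + k) k
  g-top : ∀ k → g 0 k ≡ 1
  g-top = idPrefixCount-diagonal
  g-edge : ∀ a → g (suc a) 0 ≡ g a 1
  g-edge a = trans (idPrefixCount-0≡1 (suc a + 0)) (cong (λ n → idPrefixCount n 1) (trans (+-identityʳ (suc a)) (+-comm 1 a)))
  g-rec : ∀ a k → g (suc a) (suc k) ≡ g (suc a) k + g a (suc (suc k))
  g-rec a k = trans (idPrefixCount-recurrence {a + suc k} {k} (m≤n+m (suc k) a))
                    (cong₂ _+_ (cong (λ n → idPrefixCount n k) (+-suc a k)) (cong (λ n → idPrefixCount n (suc (suc k))) (sym (+-suc a (suc k)))))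
  doubled : 2 * (gap + k) ∸ k ≡ gap + gap + k
  doubled = trans (cong (_∸ k) (twice gap k)) (m+n∸n≡m (gap + gap + k) k)
    where
    twice : ∀ a k → 2 * (a + k) ≡ a + a + k + k
    twice = solve-∀

-- Otherwise the next entry, at most n and distinct from it, would form an inversion.
entry≢max : ∀ {n σ} i j → Is321Avoiding n σ → suc (suc i) ≤ j → j ≤ length σ → AscendingPrefix j σ → entry σ (suc i) ≢ n
entry≢max {n} {σ} i j av i+2≤j j≤n asc entry≡n = asc (entry σ (suc i) , entry σ (suc (suc i)) , next<entry , pair⊆)
  where
  perm = isPermutation av
  pair⊆ = entries⊆take i j σ i+2≤j j≤n
  distinct : entry σ (suc i) ≢ entry σ (suc (suc i))
  distinct with Unique-⊆ (⊆-trans pair⊆ (take-⊆ j σ)) (unique perm)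
  ... | (≢next All.∷ _) ∷ _ = ≢next
  next<entry : entry σ (suc (suc i)) < entry σ (suc i)
  next<entry = subst (_ <_) (sym entry≡n)
    (≤∧≢⇒< (proj₂ (bounded perm (∈-⊆ (take-⊆ j σ) (∈-⊆ pair⊆ (there (here refl)))))) (λ eq → distinct (trans entry≡n (sym eq))))

struckAt? : ∀ n k → Decidable (λ σ → AscendingPrefix k σ × entry σ k ≡ n)
struckAt? n k σ = ascendingPrefix? k σ ×-dec (entry σ k ≟ n)

idPrefixStrikeCount : ℕ → ℕ → ℕ
idPrefixStrikeCount n k = count (struckAt? n k) (Av n)

idPrefixStrikeCount-step : ∀ {n k} → k ≤ n →
  idPrefixStrikeCount (suc n) (suc k) ≡ idPrefixStrikeCount n k + ∑[ i < n ∸ k ] insertionCount (struckAt? (suc n) (suc k)) n (suc k + i)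
idPrefixStrikeCount-step {n} {k} k≤n = begin
  idPrefixStrikeCount (suc n) (suc k)                ≡⟨ count-Av-suc (struckAt? (suc n) (suc k)) n ⟩
  sumBelow (suc n) t                                 ≡⟨ cong (λ m → sumBelow (suc m) t) (m+[n∸m]≡n k≤n) ⟨
  sumBelow (suc k + (n ∸ k)) t                       ≡⟨ ∑-split (suc k) (n ∸ k) t ⟩
  sumBelow (suc k) t + ∑[ i < n ∸ k ] t (suc k + i)  ≡⟨ cong (_+ ∑[ i < n ∸ k ] t (suc k + i)) (trans (cong₂ _+_ first (∑-zero k middle)) (+-identityʳ _)) ⟩
  idPrefixStrikeCount n k + ∑[ i < n ∸ k ] t (suc k + i) ∎
  where
  open ≡-Reasoning
  t = insertionCount (struckAt? (suc n) (suc k)) n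
  first : t 0 ≡ idPrefixStrikeCount n k
  first = count-cong (insertedAt? (struckAt? (suc n) (suc k)) 0) (struckAt? n k) (Av n)
    (λ {σ} σ∈ ((asc , entry≡) , _) → AscendingPrefix-insertOne-zero⁻ k σ asc ,
                                    suc-injective (trans (sym (entry-insertOne-zero k σ (≤-length-Av n σ∈ k≤n))) entry≡))
    (λ {σ} σ∈ (asc , entry≡) → (AscendingPrefix-insertOne-zero⁺ k σ asc ,
                                trans (entry-insertOne-zero k σ (≤-length-Av n σ∈ k≤n)) (cong suc entry≡)) ,
                               AscendingPrefix-≤1 σ z≤n)
  middle : ∀ j → j < k → t (suc j) ≡ 0
  middle j j<k = count-none (insertedAt? (struckAt? (suc n) (suc k)) (suc j)) {Av n} λ σ∈ ((asc , _) , _) →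
    ¬AscendingPrefix-insertOne (suc j) k _ (s≤s z≤n) j<k (≤-length-Av n σ∈ (≤-trans j<k k≤n)) (positive-Av n σ∈) asc

insertionCount-struck-next : ∀ {n k} → suc k ≤ n →
  insertionCount (struckAt? (suc n) (suc k)) n (suc k) ≡ idPrefixStrikeCount n (suc k)
insertionCount-struck-next {n} {k} k<n = count-cong (insertedAt? (struckAt? (suc n) (suc k)) (suc k)) (struckAt? n (suc k)) (Av n)
  (λ {σ} σ∈ ((_ , entry≡) , asc) → asc , suc-injective (trans (sym (entry-shift {σ} σ∈)) entry≡))
  (λ {σ} σ∈ (asc , entry≡) → (Equivalence.from (AscendingPrefix-insertOne-early (suc k) (suc k) σ ≤-refl (≤-length-Av n σ∈ k<n)) asc ,
                             trans (entry-shift {σ} σ∈) (cong suc entry≡)) , asc)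
  where
  entry-shift : ∀ {σ} → σ ∈ Av n → entry (insertOne (suc k) σ) (suc k) ≡ suc (entry σ (suc k))
  entry-shift {σ} σ∈ = entry-insertOne-early (suc k) k σ ≤-refl (≤-length-Av n σ∈ k<n)

insertionCount-struck-beyond : ∀ {n k i} → suc k + suc i ≤ n →
  insertionCount (struckAt? (suc n) (suc k)) n (suc k + suc i) ≡ 0
insertionCount-struck-beyond {n} {k} {i} j≤n = count-none (insertedAt? (struckAt? (suc n) (suc k)) j) {Av n} λ {σ} σ∈ ((_ , entry≡) , asc) →
  entry≢max k j (∈-Av⁻ σ∈) (s≤s (m<m+n k (s≤s z≤n))) (≤-length-Av n σ∈ j≤n) asc
    (suc-injective (trans (sym (entry-insertOne-early j k σ (s≤s (m≤m+n k (suc i))) (≤-length-Av n σ∈ j≤n))) entry≡))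
  where j = suc k + suc i

-- Besides the insertion in front, only the one right after position k + 1 contributes:
-- further right, the ascending prefix would need an entry above n after the entry n.
idPrefixStrikeCount-recurrence : ∀ {n k} → suc k ≤ n →
  idPrefixStrikeCount (suc n) (suc k) ≡ idPrefixStrikeCount n k + idPrefixStrikeCount n (suc k)
idPrefixStrikeCount-recurrence {n} {k} k<n = begin
  idPrefixStrikeCount (suc n) (suc k)                          ≡⟨ idPrefixStrikeCount-step (<⇒≤ k<n) ⟩
  G n k + sumBelow (n ∸ k) tail                                ≡⟨ cong (λ m → G n k + sumBelow m tail) (+-∸-assoc 1 k<n) ⟩
  G n k + (tail 0 + ∑[ i < n ∸ suc k ] tail (suc i))          ≡⟨ cong (G n k +_) (cong₂ _+_ next (∑-zero (n ∸ suc k) beyond)) ⟩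
  G n k + (G n (suc k) + 0)                                    ≡⟨ cong (G n k +_) (+-identityʳ _) ⟩
  G n k + G n (suc k)                                          ∎
  where
  open ≡-Reasoning
  G = idPrefixStrikeCount
  tail = λ i → insertionCount (struckAt? (suc n) (suc k)) n (suc k + i)
  next : tail 0 ≡ G n (suc k)
  next = trans (cong (insertionCount (struckAt? (suc n) (suc k)) n) (+-identityʳ (suc k))) (insertionCount-struck-next k<n)
  beyond : ∀ i → i < n ∸ suc k → tail (suc i) ≡ 0
  beyond i i<n∸k = insertionCount-struck-beyond (subst (_≤ n) (cong suc (sym (+-suc k i))) (insertion-offset≤ k<n i<n∸k))

idPrefixStrikeCount-diagonal : ∀ n → idPrefixStrikeCount (suc n) (suc n) ≡ idPrefixStrikeCount n n
idPrefixStrikeCount-diagonal n = begin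
  idPrefixStrikeCount (suc n) (suc n)                              ≡⟨ idPrefixStrikeCount-step {n} {n} ≤-refl ⟩
  idPrefixStrikeCount n n + sumBelow (n ∸ n) tail                  ≡⟨ cong (λ m → idPrefixStrikeCount n n + sumBelow m tail) (n∸n≡0 n) ⟩
  idPrefixStrikeCount n n + 0                                      ≡⟨ +-identityʳ _ ⟩
  idPrefixStrikeCount n n                                          ∎
  where
  open ≡-Reasoning
  tail = λ i → insertionCount (struckAt? (suc n) (suc n)) n (suc n + i)

idPrefixStrikeCount-zero : ∀ n → idPrefixStrikeCount (suc n) 0 ≡ 0
idPrefixStrikeCount-zero n = count-none (struckAt? (suc n) 0) {Av (suc n)} λ {π} _ (_ , entry≡) → 0≢1+n (trans (sym (entry-zero π)) entry≡)

idPrefixStrikeCount-closed : ∀ n k → k ≤ n → idPrefixStrikeCount (suc n) (suc k) ≡ n C k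
idPrefixStrikeCount-closed zero    zero    _ = idPrefixStrikeCount-diagonal 0
idPrefixStrikeCount-closed (suc m) zero    _ = begin
  idPrefixStrikeCount (suc (suc m)) 1                         ≡⟨ idPrefixStrikeCount-recurrence {suc m} {0} (s≤s z≤n) ⟩
  idPrefixStrikeCount (suc m) 0 + idPrefixStrikeCount (suc m) 1 ≡⟨ cong₂ _+_ (idPrefixStrikeCount-zero m) (idPrefixStrikeCount-closed m 0 z≤n) ⟩
  m C 0                                                       ∎
  where open ≡-Reasoning
idPrefixStrikeCount-closed (suc m) (suc k) (s≤s k≤m) with m≤n⇒m<n∨m≡n k≤m
... | inj₁ k<m = begin
  idPrefixStrikeCount (suc (suc m)) (suc (suc k))                      ≡⟨ idPrefixStrikeCount-recurrence {suc m} {suc k} (s≤s k<m) ⟩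
  idPrefixStrikeCount (suc m) (suc k) + idPrefixStrikeCount (suc m) (suc (suc k))
                                                                       ≡⟨ cong₂ _+_ (idPrefixStrikeCount-closed m k k≤m) (idPrefixStrikeCount-closed m (suc k) k<m) ⟩
  m C k + m C suc k                                                    ≡⟨ nCk+nC[k+1]≡[n+1]C[k+1] m k ⟩
  suc m C suc k                                                        ∎
  where open ≡-Reasoning
... | inj₂ refl = begin
  idPrefixStrikeCount (suc (suc m)) (suc (suc m))  ≡⟨ idPrefixStrikeCount-diagonal (suc m) ⟩
  idPrefixStrikeCount (suc m) (suc m)              ≡⟨ idPrefixStrikeCount-closed m m ≤-refl ⟩
  m C m                                            ≡⟨ nCn≡1 m ⟩
  1                                                ≡⟨ nCn≡1 (suc m) ⟨
  suc m C suc m                                    ∎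
  where open ≡-Reasoning

S-idPrefix : ∀ N k → k ≤ N → S N (idPrefix k) ≡ (idPrefixStrikeCount N k , idPrefixCount N k)
S-idPrefix N k k≤N rewrite length-range k =
  cong₂ _,_ (count-cong _ (struckAt? N k) (Av N) (λ _ → Product.map (prefixFlat≡range⇒ascending k _) id)
                                                 (λ π∈ → Product.map (ascending⇒prefixFlat≡range k (perm π∈) k≤N) id))
            (count-cong _ (ascendingPrefix? k) (Av N) (λ _ → prefixFlat≡range⇒ascending k _)
                                                      (λ π∈ → ascending⇒prefixFlat≡range k (perm π∈) k≤N))
  where
  perm : ∀ {π} → π ∈ Av N → IsPermutation N π
  perm = isPermutation ∘ ∈-Av⁻

strike-idPrefix : (N k : ℕ) → 1 ≤ k → k ≤ N →
                  (proj₁ (S N (idPrefix k)) ≡ (N ∸ 1) C (k ∸ 1)) × ((N + 1) * proj₂ (S N (idPrefix k)) ≡ (k + 1) * ((2 * N ∸ k) C N))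
strike-idPrefix (suc n) (suc k) _ k≤N =
  trans (cong proj₁ S≡) (idPrefixStrikeCount-closed n k (≤-pred k≤N)) ,
  trans (cong ((suc n + 1) *_) (cong proj₂ S≡)) (idPrefixCount-closed (suc n) (suc k) k≤N)
  where S≡ = S-idPrefix (suc n) (suc k) k≤N

theorem4p1 : (N : ℕ) → 1 ≤ N →
    ((p : List ℕ) → IsPrefix N p → Eligible p → HasInversion p →
       S N p ≡ S (N ∸ 1) (removeOne p))
    × ((k : ℕ) → 1 ≤ k → k ≤ N →
       (proj₁ (S N (idPrefix k)) ≡ (N ∸ 1) C (k ∸ 1))
       × ((N + 1) * proj₂ (S N (idPrefix k)) ≡ (k + 1) * ((2 * N ∸ k) C N)))
theorem4p1 N 1≤N = strike-removeOne N 1≤N , strike-idPrefix N
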